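{- For an integer $k>1$ let $M_k$ denote the $k\times k$ Collatz matrix (defined in the context), viewed as a matrix over the polynomial ring $\mathbb{Z}[x]$. Let $l$ be a positive integer. (a) Suppose $k=44+54l$. Then $\det M_k=\det M_{k-1}$ in each of the following cases: (i) $3\mid l$ or $3\mid (l-1)$; (ii) $l=2+3l_1$ for an integer $l_1$ with $3\mid (l_1-1)$; (iii) $l=2+3l_1$ for an integer $l_1$, and either (1) $l_1=3l_2$ for an integer $l_2$ with $3\mid l_2$, or (2) $l_1=2+3l_2$ for an integer $l_2$ with $3\mid l_2$ or $3\mid (l_2-1)$. (b) Suppose $k=26+54l$. Then $\det M_k=\det M_{k-1}$ in each of the following cases: (i) $3\mid (l-2)$; (ii) either (1) $l=1+3l_1$ for an integer $l_1$ with $3\mid l_1$, or (2) $l=3l_1$ for an integer $l_1$ with $3\mid l_1$.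
   Context: For each integer $k>1$, the Collatz matrix $M_k$ is the $k\times k$ matrix with entries in $\mathbb{Z}[x]$ (indeterminate $x$) defined as follows, with rows and columns indexed by $1,\dots,k$: every diagonal entry $(i,i)$ equals $1$; for each even $i$ with $1<i\le k$, the $(i,i/2)$-entry equals $x$; for each odd $i$ with $\frac{3i+1}{2}\le k$, the $(i,\frac{3i+1}{2})$-entry equals $x$; all other entries are $0$. For example, $M_2=\begin{pmatrix}1&x\\ x&1\end{pmatrix}$ and $M_4=\begin{pmatrix}1&x&0&0\\ x&1&0&0\\ 0&0&1&0\\ 0&x&0&1\end{pmatrix}$. -}

module Defs where

open import Data.Nat as ℕ using (ℕ; zero; suc)
open import Data.Nat.DivMod using (_/_; _%_)
open import Data.Integer as ℤ using (ℤ; +_)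
open import Data.Fin using (Fin; toℕ; punchIn)
import Data.Fin as Fin
open import Data.List using (List; []; _∷_)
open import Data.Bool using (Bool; true; false; if_then_else_; _∧_; _∨_)
open import Relation.Binary.PropositionalEquality using (_≡_)

-- The polynomial ring ℤ[x]: coefficient lists, lowest degree first.

Poly : Set
Poly = List ℤ

coeff : Poly → ℕ → ℤ
coeff []       _       = + 0
coeff (a ∷ p)  zero    = a
coeff (a ∷ p)  (suc i) = coeff p i

-- equality in ℤ[x]: all coefficients agree (trailing zeros irrelevant)
infix 4 _≈ₚ_
_≈ₚ_ : Poly → Poly → Set
p ≈ₚ q = ∀ i → coeff p i ≡ coeff q i

0ₚ 1ₚ xₚ : Poly
0ₚ = []
1ₚ = + 1 ∷ []
xₚ = + 0 ∷ + 1 ∷ []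

infixl 6 _+ₚ_
infixl 7 _*ₚ_ _·ₚ_

_+ₚ_ : Poly → Poly → Poly
[]      +ₚ q       = q
(a ∷ p) +ₚ []      = a ∷ p
(a ∷ p) +ₚ (b ∷ q) = (a ℤ.+ b) ∷ (p +ₚ q)

_·ₚ_ : ℤ → Poly → Poly
c ·ₚ []      = []
c ·ₚ (a ∷ p) = (c ℤ.* a) ∷ (c ·ₚ p)

-ₚ_ : Poly → Poly
-ₚ p = ℤ.-[1+ 0 ] ·ₚ p

_*ₚ_ : Poly → Poly → Poly
[]      *ₚ q = []
(a ∷ p) *ₚ q = (a ·ₚ q) +ₚ (+ 0 ∷ (p *ₚ q))

Matrix : ℕ → Set
Matrix n = Fin n → Fin n → Poly

altSum : (n : ℕ) → (Fin n → Poly) → Poly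
altSum zero    f = 0ₚ
altSum (suc n) f = f Fin.zero +ₚ (-ₚ altSum n (λ j → f (Fin.suc j)))

det : (n : ℕ) → Matrix n → Poly
det zero    A = 1ₚ
det (suc n) A =
  altSum (suc n) (λ j → A Fin.zero j *ₚ det n (λ r c → A (Fin.suc r) (punchIn j c)))

-- The Collatz matrix M_k (rows/columns indexed 1..k; Fin k index t
-- stands for t+1).

collatzEntry : ℕ → ℕ → Poly
collatzEntry i j =
  if i ℕ.≡ᵇ j then 1ₚ
  else if ((i % 2) ℕ.≡ᵇ 0) ∧ (1 ℕ.<ᵇ i) ∧ (j ℕ.≡ᵇ (i / 2)) then xₚ
  else if ((i % 2) ℕ.≡ᵇ 1) ∧ (j ℕ.≡ᵇ ((3 ℕ.* i ℕ.+ 1) / 2)) then xₚ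
  else 0ₚ

M : (k : ℕ) → Matrix k
M k r c = collatzEntry (suc (toℕ r)) (suc (toℕ c))

-- Column j of M_k has 1 in row j and x in the rows i ≤ k that the Collatz map sends to j: row 2j
-- and, when it is an odd integer, row (2j - 1)/3. In particular column k is e_k + x e_{(2k-1)/3}.
-- Adding multiples of other columns to the last one does not change the determinant, so the
-- off-diagonal entries can be cleared one node at a time, walking down the backward Collatz tree
-- of k; this terminates when that tree, cut off above k, is finite and avoids k. The last column
-- is then e_k, and expanding along it gives det M_{k-1}.
-- When k = c₀ + c₁ L runs through an arithmetic progression, every node is an affine function of
-- L, and whether 2y ≤ k and whether (2y - 1)/3 is an odd integer can be decided uniformly in L, so
-- the tree is certified once per progression by evaluation. The hypotheses on l place k in one of
-- finitely many such progressions.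

module Submission where

open import Defs
open import Algebra.Bundles using (CommutativeRing)
import Data.Integer.Properties as ℤP
open import Algebra.Properties.CommutativeSemigroup ℤP.+-commutativeSemigroup
  using () renaming (interchange to +-interchange)
open import Data.Bool using (Bool; true; false; if_then_else_; _∧_; T)
open import Data.Bool.ListAction using (all)
open import Data.Bool.Properties using (T-∧)
open import Data.Empty using (⊥; ⊥-elim)
open import Data.Fin using (Fin; zero; suc; punchIn; punchOut; inject₁; fromℕ; fromℕ<; toℕ)
open import Data.Fin.Properties
  using (_≟_; suc-injective; toℕ-injective; toℕ<n; toℕ-inject₁; toℕ-inject₁-≢; toℕ-fromℕ; toℕ-fromℕ<; fromℕ≢inject₁;
         punchIn-injective; punchInᵢ≢i; punchIn-punchOut)
open import Data.Integer as ℤ using (ℤ; +_; -[1+_]; ∣_∣)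
open import Data.Integer.Divisibility using (_∣_)
import Data.Integer.Tactic.RingSolver as ℤ-Solver
open import Data.List using (List; []; _∷_)
open import Data.List.Relation.Unary.Any using (Any; here; there)
open import Data.Maybe as Maybe using (Maybe; just; nothing)
import Data.Maybe.Relation.Unary.All as MaybeAll
open import Data.Nat as ℕ using (ℕ; zero; suc; _+_; _*_; _∸_; _≤_; _<_; _≡ᵇ_; _<ᵇ_; z≤n; s≤s)
open import Data.Nat.Divisibility using (divides)
open import Data.Nat.DivMod using (_%_; _/_; m≡m%n+[m/n]*n; m*n%n≡0; m*n/n≡m; [m+kn]%n≡m%n)
import Data.Nat.Properties as ℕP
import Data.Nat.Tactic.RingSolver as ℕ-Solver
open import Data.Product using (Σ; _×_; _,_; ∃; proj₁; proj₂)
open import Data.Sum using (_⊎_; inj₁; inj₂)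
open import Function using (_∘_; case_of_)
open import Function.Bundles using (Equivalence)
open import Relation.Binary.Definitions using (tri<; tri≈; tri>)
open import Relation.Binary.PropositionalEquality as ≡ using (_≡_; _≢_; refl; cong; cong₂)
import Relation.Binary.Reasoning.Setoid as SetoidReasoning
open import Relation.Nullary using (¬_; Dec; yes; no; _×-dec_)
open import Relation.Nullary.Reflects as Reflects using (Reflects; ofʸ; ofⁿ; _×-reflects_)
import Tactic.RingSolver as RingSolver
import Tactic.RingSolver.Core.AlmostCommutativeRing as ACR

-- The ring ℤ[x]

-- Coefficientwise equality wrapped in a record so that its endpoints can be inferred.
infix 4 _≋_
record _≋_ (p q : Poly) : Set where
  constructor coeffwise
  field ≋⇒≈ₚ : p ≈ₚ q
open _≋_ public

≋-refl : ∀ {p} → p ≋ p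
≋-refl = coeffwise λ _ → refl

≋-sym : ∀ {p q} → p ≋ q → q ≋ p
≋-sym (coeffwise e) = coeffwise λ i → ≡.sym (e i)

≋-trans : ∀ {p q r} → p ≋ q → q ≋ r → p ≋ r
≋-trans (coeffwise e) (coeffwise f) = coeffwise λ i → ≡.trans (e i) (f i)

≡⇒≋ : ∀ {p q} → p ≡ q → p ≋ q
≡⇒≋ refl = ≋-refl

coeff-+ₚ : ∀ p q i → coeff (p +ₚ q) i ≡ coeff p i ℤ.+ coeff q i
coeff-+ₚ []      q       i       = ≡.sym (ℤP.+-identityˡ _)
coeff-+ₚ (a ∷ p) []      zero    = ≡.sym (ℤP.+-identityʳ a)
coeff-+ₚ (a ∷ p) []      (suc i) = ≡.sym (ℤP.+-identityʳ _)
coeff-+ₚ (a ∷ p) (b ∷ q) zero    = refl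
coeff-+ₚ (a ∷ p) (b ∷ q) (suc i) = coeff-+ₚ p q i

coeff-·ₚ : ∀ c p i → coeff (c ·ₚ p) i ≡ c ℤ.* coeff p i
coeff-·ₚ c []      i       = ≡.sym (ℤP.*-zeroʳ c)
coeff-·ₚ c (a ∷ p) zero    = refl
coeff-·ₚ c (a ∷ p) (suc i) = coeff-·ₚ c p i

+ₚ-cong : ∀ {p p′ q q′} → p ≋ p′ → q ≋ q′ → p +ₚ q ≋ p′ +ₚ q′
+ₚ-cong {p} {p′} {q} {q′} (coeffwise e) (coeffwise f) = coeffwise λ i →
  ≡.trans (coeff-+ₚ p q i) (≡.trans (cong₂ ℤ._+_ (e i) (f i)) (≡.sym (coeff-+ₚ p′ q′ i)))

·ₚ-congʳ : ∀ c {p p′} → p ≋ p′ → c ·ₚ p ≋ c ·ₚ p′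
·ₚ-congʳ c {p} {p′} (coeffwise e) = coeffwise λ i →
  ≡.trans (coeff-·ₚ c p i) (≡.trans (cong (c ℤ.*_) (e i)) (≡.sym (coeff-·ₚ c p′ i)))

∷-cong : ∀ {a b p q} → a ≡ b → p ≋ q → a ∷ p ≋ b ∷ q
∷-cong e (coeffwise f) = coeffwise λ { zero → e ; (suc i) → f i }

shift-zero : + 0 ∷ [] ≋ 0ₚ
shift-zero = coeffwise λ { zero → refl ; (suc i) → refl }

+ₚ-comm : ∀ p q → p +ₚ q ≋ q +ₚ p
+ₚ-comm p q = coeffwise λ i →
  ≡.trans (coeff-+ₚ p q i) (≡.trans (ℤP.+-comm (coeff p i) (coeff q i)) (≡.sym (coeff-+ₚ q p i)))

+ₚ-assoc : ∀ p q r → (p +ₚ q) +ₚ r ≋ p +ₚ (q +ₚ r)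
+ₚ-assoc p q r = coeffwise λ i → begin
  coeff ((p +ₚ q) +ₚ r) i                    ≡⟨ coeff-+ₚ (p +ₚ q) r i ⟩
  coeff (p +ₚ q) i ℤ.+ coeff r i             ≡⟨ cong (λ z → z ℤ.+ coeff r i) (coeff-+ₚ p q i) ⟩
  (coeff p i ℤ.+ coeff q i) ℤ.+ coeff r i    ≡⟨ ℤP.+-assoc (coeff p i) (coeff q i) (coeff r i) ⟩
  coeff p i ℤ.+ (coeff q i ℤ.+ coeff r i)    ≡⟨ cong (λ z → coeff p i ℤ.+ z) (coeff-+ₚ q r i) ⟨
  coeff p i ℤ.+ coeff (q +ₚ r) i             ≡⟨ coeff-+ₚ p (q +ₚ r) i ⟨
  coeff (p +ₚ (q +ₚ r)) i                    ∎
  where open ≡.≡-Reasoning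

+ₚ-identityʳ : ∀ p → p +ₚ 0ₚ ≋ p
+ₚ-identityʳ []      = ≋-refl
+ₚ-identityʳ (a ∷ p) = ≋-refl

coeff-negₚ : ∀ p i → coeff (-ₚ p) i ≡ ℤ.- coeff p i
coeff-negₚ p i = ≡.trans (coeff-·ₚ _ p i) (ℤP.-1*i≡-i _)

-ₚ-inverseʳ : ∀ p → p +ₚ (-ₚ p) ≋ 0ₚ
-ₚ-inverseʳ p = coeffwise λ i → ≡.trans (coeff-+ₚ p (-ₚ p) i)
  (≡.trans (cong (λ z → coeff p i ℤ.+ z) (coeff-negₚ p i)) (ℤP.+-inverseʳ (coeff p i)))

-ₚ-inverseˡ : ∀ p → (-ₚ p) +ₚ p ≋ 0ₚ
-ₚ-inverseˡ p = ≋-trans (+ₚ-comm (-ₚ p) p) (-ₚ-inverseʳ p)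

·ₚ-distrib-+ₚ : ∀ c p q → c ·ₚ (p +ₚ q) ≋ c ·ₚ p +ₚ c ·ₚ q
·ₚ-distrib-+ₚ c p q = coeffwise λ i → begin
  coeff (c ·ₚ (p +ₚ q)) i                        ≡⟨ coeff-·ₚ c (p +ₚ q) i ⟩
  c ℤ.* coeff (p +ₚ q) i                         ≡⟨ cong (c ℤ.*_) (coeff-+ₚ p q i) ⟩
  c ℤ.* (coeff p i ℤ.+ coeff q i)                ≡⟨ ℤP.*-distribˡ-+ c (coeff p i) (coeff q i) ⟩
  c ℤ.* coeff p i ℤ.+ c ℤ.* coeff q i            ≡⟨ cong₂ ℤ._+_ (coeff-·ₚ c p i) (coeff-·ₚ c q i) ⟨
  coeff (c ·ₚ p) i ℤ.+ coeff (c ·ₚ q) i          ≡⟨ coeff-+ₚ (c ·ₚ p) (c ·ₚ q) i ⟨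
  coeff (c ·ₚ p +ₚ c ·ₚ q) i                     ∎
  where open ≡.≡-Reasoning

+-distrib-·ₚ : ∀ a b p → (a ℤ.+ b) ·ₚ p ≋ a ·ₚ p +ₚ b ·ₚ p
+-distrib-·ₚ a b p = coeffwise λ i → begin
  coeff ((a ℤ.+ b) ·ₚ p) i                       ≡⟨ coeff-·ₚ (a ℤ.+ b) p i ⟩
  (a ℤ.+ b) ℤ.* coeff p i                        ≡⟨ ℤP.*-distribʳ-+ (coeff p i) a b ⟩
  a ℤ.* coeff p i ℤ.+ b ℤ.* coeff p i            ≡⟨ cong₂ ℤ._+_ (coeff-·ₚ a p i) (coeff-·ₚ b p i) ⟨
  coeff (a ·ₚ p) i ℤ.+ coeff (b ·ₚ p) i          ≡⟨ coeff-+ₚ (a ·ₚ p) (b ·ₚ p) i ⟨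
  coeff (a ·ₚ p +ₚ b ·ₚ p) i                     ∎
  where open ≡.≡-Reasoning

·ₚ-assoc : ∀ a b p → (a ℤ.* b) ·ₚ p ≋ a ·ₚ (b ·ₚ p)
·ₚ-assoc a b p = coeffwise λ i → ≡.trans (coeff-·ₚ (a ℤ.* b) p i)
  (≡.trans (ℤP.*-assoc a b (coeff p i))
    (≡.sym (≡.trans (coeff-·ₚ a (b ·ₚ p) i) (cong (a ℤ.*_) (coeff-·ₚ b p i)))))

0·ₚ : ∀ p → + 0 ·ₚ p ≋ 0ₚ
0·ₚ p = coeffwise (coeff-·ₚ (+ 0) p)

1·ₚ : ∀ p → + 1 ·ₚ p ≋ p
1·ₚ p = coeffwise λ i → ≡.trans (coeff-·ₚ (+ 1) p i) (ℤP.*-identityˡ (coeff p i))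

·ₚ-shift : ∀ c p → c ·ₚ (+ 0 ∷ p) ≋ + 0 ∷ (c ·ₚ p)
·ₚ-shift c p = ∷-cong (ℤP.*-zeroʳ c) ≋-refl

+ₚ-interchange : ∀ a b c d → (a +ₚ b) +ₚ (c +ₚ d) ≋ (a +ₚ c) +ₚ (b +ₚ d)
+ₚ-interchange a b c d = coeffwise λ i → begin
  coeff ((a +ₚ b) +ₚ (c +ₚ d)) i
    ≡⟨ ≡.trans (coeff-+ₚ (a +ₚ b) (c +ₚ d) i) (cong₂ ℤ._+_ (coeff-+ₚ a b i) (coeff-+ₚ c d i)) ⟩
  (coeff a i ℤ.+ coeff b i) ℤ.+ (coeff c i ℤ.+ coeff d i)
    ≡⟨ +-interchange (coeff a i) (coeff b i) (coeff c i) (coeff d i) ⟩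
  (coeff a i ℤ.+ coeff c i) ℤ.+ (coeff b i ℤ.+ coeff d i)
    ≡⟨ ≡.trans (coeff-+ₚ (a +ₚ c) (b +ₚ d) i) (cong₂ ℤ._+_ (coeff-+ₚ a c i) (coeff-+ₚ b d i)) ⟨
  coeff ((a +ₚ c) +ₚ (b +ₚ d)) i ∎
  where open ≡.≡-Reasoning

*ₚ-zeroʳ : ∀ p → p *ₚ 0ₚ ≋ 0ₚ
*ₚ-zeroʳ []      = ≋-refl
*ₚ-zeroʳ (a ∷ p) = ≋-trans (∷-cong refl (*ₚ-zeroʳ p)) shift-zero

*ₚ-congʳ : ∀ p {q q′} → q ≋ q′ → p *ₚ q ≋ p *ₚ q′
*ₚ-congʳ []      e = ≋-refl
*ₚ-congʳ (a ∷ p) e = +ₚ-cong (·ₚ-congʳ a e) (∷-cong refl (*ₚ-congʳ p e))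

≋0⇒*ₚ≋0 : ∀ {p} q → p ≋ 0ₚ → p *ₚ q ≋ 0ₚ
≋0⇒*ₚ≋0 {[]}    q e = ≋-refl
≋0⇒*ₚ≋0 {a ∷ p} q (coeffwise e) with e zero
... | refl = ≋-trans (+ₚ-cong (0·ₚ q) (∷-cong refl (≋0⇒*ₚ≋0 {p} q (coeffwise λ i → e (suc i))))) shift-zero

*ₚ-congˡ : ∀ {p p′} q → p ≋ p′ → p *ₚ q ≋ p′ *ₚ q
*ₚ-congˡ {[]}    {p′}     q e = ≋-sym (≋0⇒*ₚ≋0 q (≋-sym e))
*ₚ-congˡ {a ∷ p} {[]}     q e = ≋0⇒*ₚ≋0 q e
*ₚ-congˡ {a ∷ p} {b ∷ p′} q (coeffwise e) with e zero
... | refl = +ₚ-cong ≋-refl (∷-cong refl (*ₚ-congˡ {p} {p′} q (coeffwise λ i → e (suc i))))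

*ₚ-cong : ∀ {p p′ q q′} → p ≋ p′ → q ≋ q′ → p *ₚ q ≋ p′ *ₚ q′
*ₚ-cong {p′ = p′} {q} e f = ≋-trans (*ₚ-congˡ q e) (*ₚ-congʳ p′ f)

*ₚ-distribʳ : ∀ p q r → (p +ₚ q) *ₚ r ≋ p *ₚ r +ₚ q *ₚ r
*ₚ-distribʳ []      q       r = ≋-refl
*ₚ-distribʳ (a ∷ p) []      r = ≋-sym (+ₚ-identityʳ _)
*ₚ-distribʳ (a ∷ p) (b ∷ q) r = ≋-trans
  (+ₚ-cong (+-distrib-·ₚ a b r) (∷-cong refl (*ₚ-distribʳ p q r)))
  (+ₚ-interchange (a ·ₚ r) (b ·ₚ r) (+ 0 ∷ (p *ₚ r)) (+ 0 ∷ (q *ₚ r)))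

*ₚ-distribˡ : ∀ p q r → p *ₚ (q +ₚ r) ≋ p *ₚ q +ₚ p *ₚ r
*ₚ-distribˡ []      q r = ≋-refl
*ₚ-distribˡ (a ∷ p) q r = ≋-trans
  (+ₚ-cong (·ₚ-distrib-+ₚ a q r) (∷-cong refl (*ₚ-distribˡ p q r)))
  (+ₚ-interchange (a ·ₚ q) (a ·ₚ r) (+ 0 ∷ (p *ₚ q)) (+ 0 ∷ (p *ₚ r)))

·ₚ-*ₚ-assoc : ∀ a q r → (a ·ₚ q) *ₚ r ≋ a ·ₚ (q *ₚ r)
·ₚ-*ₚ-assoc a []      r = ≋-refl
·ₚ-*ₚ-assoc a (b ∷ q) r = ≋-trans
  (+ₚ-cong (·ₚ-assoc a b r) (≋-trans (∷-cong refl (·ₚ-*ₚ-assoc a q r)) (≋-sym (·ₚ-shift a (q *ₚ r)))))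
  (≋-sym (·ₚ-distrib-+ₚ a (b ·ₚ r) (+ 0 ∷ (q *ₚ r))))

*ₚ-assoc : ∀ p q r → (p *ₚ q) *ₚ r ≋ p *ₚ (q *ₚ r)
*ₚ-assoc []      q r = ≋-refl
*ₚ-assoc (a ∷ p) q r = ≋-trans (*ₚ-distribʳ (a ·ₚ q) (+ 0 ∷ (p *ₚ q)) r)
  (+ₚ-cong (·ₚ-*ₚ-assoc a q r) (+ₚ-cong (0·ₚ r) (∷-cong refl (*ₚ-assoc p q r))))

*ₚ-∷ʳ : ∀ p b q → p *ₚ (b ∷ q) ≋ b ·ₚ p +ₚ (+ 0 ∷ (p *ₚ q))
*ₚ-∷ʳ []      b q = ≋-sym shift-zero
*ₚ-∷ʳ (a ∷ p) b q = ≋-trans (+ₚ-cong (≋-refl {a ·ₚ (b ∷ q)}) (∷-cong refl (*ₚ-∷ʳ p b q))) (coeffwise swap)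
  where
  swap : a ·ₚ (b ∷ q) +ₚ (+ 0 ∷ (b ·ₚ p +ₚ (+ 0 ∷ (p *ₚ q))))
         ≈ₚ b ·ₚ (a ∷ p) +ₚ (+ 0 ∷ (a ·ₚ q +ₚ (+ 0 ∷ (p *ₚ q))))
  swap zero    = cong (λ z → z ℤ.+ + 0) (ℤP.*-comm a b)
  swap (suc i) = ≋⇒≈ₚ (≋-trans (≋-sym (+ₚ-assoc (a ·ₚ q) (b ·ₚ p) _))
    (≋-trans (+ₚ-cong (+ₚ-comm (a ·ₚ q) (b ·ₚ p)) ≋-refl) (+ₚ-assoc (b ·ₚ p) (a ·ₚ q) _))) i

*ₚ-comm : ∀ p q → p *ₚ q ≋ q *ₚ p
*ₚ-comm p []      = *ₚ-zeroʳ p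
*ₚ-comm p (b ∷ q) = ≋-trans (*ₚ-∷ʳ p b q) (+ₚ-cong ≋-refl (∷-cong refl (*ₚ-comm p q)))

*ₚ-identityˡ : ∀ p → 1ₚ *ₚ p ≋ p
*ₚ-identityˡ p = ≋-trans (+ₚ-cong ≋-refl shift-zero) (≋-trans (+ₚ-identityʳ _) (1·ₚ p))

ℤ[x]-commutativeRing : CommutativeRing _ _
ℤ[x]-commutativeRing = record
  { Carrier = Poly ; _≈_ = _≋_ ; _+_ = _+ₚ_ ; _*_ = _*ₚ_ ; -_ = -ₚ_ ; 0# = 0ₚ ; 1# = 1ₚ
  ; isCommutativeRing = record
    { isRing = record
      { +-isAbelianGroup = record
        { isGroup = record
          { isMonoid = record
            { isSemigroup = record
              { isMagma = record
                { isEquivalence = record { refl = ≋-refl ; sym = ≋-sym ; trans = ≋-trans }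
                ; ∙-cong = +ₚ-cong }
              ; assoc = +ₚ-assoc }
            ; identity = (λ _ → ≋-refl) , +ₚ-identityʳ }
          ; inverse = -ₚ-inverseˡ , -ₚ-inverseʳ
          ; ⁻¹-cong = ·ₚ-congʳ _ }
        ; comm = +ₚ-comm }
      ; *-cong = *ₚ-cong
      ; *-assoc = *ₚ-assoc
      ; *-identity = *ₚ-identityˡ , (λ p → ≋-trans (*ₚ-comm p 1ₚ) (*ₚ-identityˡ p))
      ; distrib = *ₚ-distribˡ , (λ p q r → *ₚ-distribʳ q r p) }
    ; *-comm = *ₚ-comm } }

-- Deciding whether a coefficient is zero lets the ring solver cancel p +ₚ (-ₚ p).
≋0? : (p : Poly) → Maybe (0ₚ ≋ p)
≋0? []      = just ≋-refl
≋0? (+ 0 ∷ p) with ≋0? p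
... | just (coeffwise e) = just (coeffwise λ { zero → refl ; (suc i) → e i })
... | nothing            = nothing
≋0? (_ ∷ _) = nothing

ℤ[x]-almostCommutativeRing : ACR.AlmostCommutativeRing _ _
ℤ[x]-almostCommutativeRing = ACR.fromCommutativeRing ℤ[x]-commutativeRing ≋0?

-- Column operations on determinants

module ≋-Reasoning = SetoidReasoning (CommutativeRing.setoid ℤ[x]-commutativeRing)

altSum-cong : ∀ n {f g : Fin n → Poly} → (∀ j → f j ≋ g j) → altSum n f ≋ altSum n g
altSum-cong zero    e = ≋-refl
altSum-cong (suc n) e = +ₚ-cong (e zero) (·ₚ-congʳ _ (altSum-cong n (λ j → e (suc j))))

altSum-linear : ∀ n (f g : Fin n → Poly) q →
  altSum n (λ j → f j +ₚ q *ₚ g j) ≋ altSum n f +ₚ q *ₚ altSum n g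
altSum-linear zero    f g q = ≋-sym (≋-trans (+ₚ-comm _ (q *ₚ [])) (≋-trans (+ₚ-identityʳ _) (*ₚ-zeroʳ q)))
altSum-linear (suc n) f g q = begin
  (f zero +ₚ q *ₚ g zero) +ₚ (-ₚ altSum n (λ j → f (suc j) +ₚ q *ₚ g (suc j)))
    ≈⟨ +ₚ-cong ≋-refl (·ₚ-congʳ _ (altSum-linear n (λ j → f (suc j)) (λ j → g (suc j)) q)) ⟩
  (f zero +ₚ q *ₚ g zero) +ₚ (-ₚ (altSum n (λ j → f (suc j)) +ₚ q *ₚ altSum n (λ j → g (suc j))))
    ≈⟨ regroup (f zero) (g zero) (altSum n (λ j → f (suc j))) (altSum n (λ j → g (suc j))) q ⟩
  (f zero +ₚ (-ₚ altSum n (λ j → f (suc j)))) +ₚ q *ₚ (g zero +ₚ (-ₚ altSum n (λ j → g (suc j)))) ∎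
  where
  open ≋-Reasoning
  regroup : ∀ a b c d q → (a +ₚ q *ₚ b) +ₚ (-ₚ (c +ₚ q *ₚ d)) ≋ (a +ₚ (-ₚ c)) +ₚ q *ₚ (b +ₚ (-ₚ d))
  regroup = RingSolver.solve-∀ ℤ[x]-almostCommutativeRing

minor : ∀ {n} → Matrix (suc n) → Fin (suc n) → Matrix n
minor A j r c = A (suc r) (punchIn j c)

det-cong : ∀ n {A B : Matrix n} → (∀ r c → A r c ≋ B r c) → det n A ≋ det n B
det-cong zero    e = ≋-refl
det-cong (suc n) e = altSum-cong (suc n) λ j →
  *ₚ-cong (e zero j) (det-cong n (λ r c → e (suc r) (punchIn j c)))

det-linear-col : ∀ n (A B C : Matrix n) (c : Fin n) q →
  (∀ r s → s ≢ c → A r s ≋ C r s × B r s ≋ C r s) →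
  (∀ r → C r c ≋ A r c +ₚ q *ₚ B r c) →
  det n C ≋ det n A +ₚ q *ₚ det n B
det-linear-col (suc n) A B C c q others col =
  ≋-trans (altSum-cong (suc n) expand) (altSum-linear (suc n) (expansion A) (expansion B) q)
  where
  open ≋-Reasoning
  expansion : Matrix (suc n) → Fin (suc n) → Poly
  expansion X j = X zero j *ₚ det n (minor X j)
  expand : ∀ j → expansion C j ≋ expansion A j +ₚ q *ₚ expansion B j
  expand j with j ≟ c
  ... | yes refl = begin
    C zero c *ₚ det n (minor C c)
      ≈⟨ *ₚ-cong (col zero) ≋-refl ⟩
    (A zero c +ₚ q *ₚ B zero c) *ₚ det n (minor C c)
      ≈⟨ distrib (A zero c) (B zero c) q (det n (minor C c)) ⟩
    A zero c *ₚ det n (minor C c) +ₚ q *ₚ (B zero c *ₚ det n (minor C c))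
      ≈⟨ +ₚ-cong (*ₚ-congʳ (A zero c) minorA) (*ₚ-congʳ q (*ₚ-congʳ (B zero c) minorB)) ⟩
    expansion A c +ₚ q *ₚ expansion B c ∎
    where
    distrib : ∀ a b q d → (a +ₚ q *ₚ b) *ₚ d ≋ a *ₚ d +ₚ q *ₚ (b *ₚ d)
    distrib = RingSolver.solve-∀ ℤ[x]-almostCommutativeRing
    minorA : det n (minor C c) ≋ det n (minor A c)
    minorA = det-cong n λ r s → ≋-sym (proj₁ (others (suc r) (punchIn c s) (punchInᵢ≢i c s)))
    minorB : det n (minor C c) ≋ det n (minor B c)
    minorB = det-cong n λ r s → ≋-sym (proj₂ (others (suc r) (punchIn c s) (punchInᵢ≢i c s)))
  ... | no j≢c = begin
    C zero j *ₚ det n (minor C j)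
      ≈⟨ *ₚ-congʳ (C zero j) (det-linear-col n (minor A j) (minor B j) (minor C j) c′ q others′ col′) ⟩
    C zero j *ₚ (det n (minor A j) +ₚ q *ₚ det n (minor B j))
      ≈⟨ distrib (C zero j) (det n (minor A j)) q (det n (minor B j)) ⟩
    C zero j *ₚ det n (minor A j) +ₚ q *ₚ (C zero j *ₚ det n (minor B j))
      ≈⟨ +ₚ-cong (*ₚ-congˡ _ (≋-sym (proj₁ (others zero j j≢c))))
                 (*ₚ-congʳ q (*ₚ-congˡ _ (≋-sym (proj₂ (others zero j j≢c))))) ⟩
    expansion A j +ₚ q *ₚ expansion B j ∎
    where
    distrib : ∀ a x q y → a *ₚ (x +ₚ q *ₚ y) ≋ a *ₚ x +ₚ q *ₚ (a *ₚ y)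
    distrib = RingSolver.solve-∀ ℤ[x]-almostCommutativeRing
    c′ = punchOut j≢c
    others′ : ∀ r s → s ≢ c′ → minor A j r s ≋ minor C j r s × minor B j r s ≋ minor C j r s
    others′ r s s≢c′ = others (suc r) (punchIn j s)
      (λ eq → s≢c′ (punchIn-injective j s c′ (≡.trans eq (≡.sym (punchIn-punchOut j≢c)))))
    col′ : ∀ r → minor C j r c′ ≋ minor A j r c′ +ₚ q *ₚ minor B j r c′
    col′ r rewrite punchIn-punchOut j≢c = col (suc r)

altSum-zero : ∀ n (f : Fin n → Poly) → (∀ j → f j ≋ 0ₚ) → altSum n f ≋ 0ₚ
altSum-zero zero    f z = ≋-refl
altSum-zero (suc n) f z = +ₚ-cong (z zero) (·ₚ-congʳ _ (altSum-zero n (λ j → f (suc j)) (λ j → z (suc j))))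

altSum-adjacent : ∀ m (f : Fin (suc m) → Poly) (i : Fin m) →
  (∀ j → j ≢ inject₁ i → j ≢ suc i → f j ≋ 0ₚ) → f (inject₁ i) ≋ f (suc i) → altSum (suc m) f ≋ 0ₚ
altSum-adjacent (suc m) f zero z e = begin
  f zero +ₚ (-ₚ (f (suc zero) +ₚ (-ₚ altSum m (λ j → f (suc (suc j))))))
    ≈⟨ +ₚ-cong e (·ₚ-congʳ _ (+ₚ-cong ≋-refl (·ₚ-congʳ _ rest≋0))) ⟩
  f (suc zero) +ₚ (-ₚ (f (suc zero) +ₚ (-ₚ 0ₚ)))
    ≈⟨ cancel (f (suc zero)) ⟩
  0ₚ ∎
  where
  open ≋-Reasoning
  rest≋0 : altSum m (λ j → f (suc (suc j))) ≋ 0ₚ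
  rest≋0 = altSum-zero m _ (λ j → z (suc (suc j)) (λ ()) (λ ()))
  cancel : ∀ a → a +ₚ (-ₚ (a +ₚ (-ₚ 0ₚ))) ≋ 0ₚ
  cancel = RingSolver.solve-∀ ℤ[x]-almostCommutativeRing
altSum-adjacent (suc m) f (suc i) z e = +ₚ-cong (z zero (λ ()) (λ ()))
  (·ₚ-congʳ _ (altSum-adjacent m (λ j → f (suc j)) i
    (λ j j≢ j≢′ → z (suc j) (j≢ ∘ suc-injective) (j≢′ ∘ suc-injective)) e))

punchIn-inject₁-suc : ∀ {m} (i x : Fin m) →
  punchIn (inject₁ i) x ≡ punchIn (suc i) x ⊎ (punchIn (inject₁ i) x ≡ suc i × punchIn (suc i) x ≡ inject₁ i)
punchIn-inject₁-suc zero    zero    = inj₂ (refl , refl)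
punchIn-inject₁-suc zero    (suc x) = inj₁ refl
punchIn-inject₁-suc (suc i) zero    = inj₁ refl
punchIn-inject₁-suc (suc i) (suc x) with punchIn-inject₁-suc i x
... | inj₁ e       = inj₁ (cong suc e)
... | inj₂ (e , f) = inj₂ (cong suc e , cong suc f)

punchIn-adjacent : ∀ {m} (j : Fin (suc (suc m))) (i : Fin (suc m)) → j ≢ inject₁ i → j ≢ suc i →
  Σ (Fin m) λ i′ → punchIn j (inject₁ i′) ≡ inject₁ i × punchIn j (suc i′) ≡ suc i
punchIn-adjacent zero          zero    j≢ j≢′ = ⊥-elim (j≢ refl)
punchIn-adjacent zero          (suc i) j≢ j≢′ = i , refl , refl
punchIn-adjacent (suc zero)    zero    j≢ j≢′ = ⊥-elim (j≢′ refl)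
punchIn-adjacent {suc m} (suc (suc j)) zero j≢ j≢′ = zero , refl , refl
punchIn-adjacent {suc m} (suc j) (suc i) j≢ j≢′ with punchIn-adjacent j i (j≢ ∘ cong suc) (j≢′ ∘ cong suc)
... | i′ , e , f = suc i′ , cong suc e , cong suc f

det-adjacent-equal-cols : ∀ m (A : Matrix (suc m)) (i : Fin m) →
  (∀ r → A r (inject₁ i) ≋ A r (suc i)) → det (suc m) A ≋ 0ₚ
det-adjacent-equal-cols (suc m) A i e = altSum-adjacent (suc m) expansion i vanish equal
  where
  expansion : Fin (suc (suc m)) → Poly
  expansion j = A zero j *ₚ det (suc m) (minor A j)
  vanish : ∀ j → j ≢ inject₁ i → j ≢ suc i → expansion j ≋ 0ₚ
  vanish j j≢ j≢′ with punchIn-adjacent j i j≢ j≢′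
  ... | i′ , p , q = ≋-trans (*ₚ-congʳ (A zero j) (det-adjacent-equal-cols m (minor A j) i′ e′)) (*ₚ-zeroʳ (A zero j))
    where
    e′ : ∀ r → minor A j r (inject₁ i′) ≋ minor A j r (suc i′)
    e′ r rewrite p | q = e (suc r)
  minors : ∀ r x → minor A (inject₁ i) r x ≋ minor A (suc i) r x
  minors r x with punchIn-inject₁-suc i x
  ... | inj₁ p = ≡⇒≋ (cong (A (suc r)) p)
  ... | inj₂ (p , q) rewrite p | q = ≋-sym (e (suc r))
  equal : expansion (inject₁ i) ≋ expansion (suc i)
  equal = *ₚ-cong (e zero) (det-cong (suc m) minors)

inject₁≢suc : ∀ {m} (i : Fin m) → inject₁ i ≢ suc i
inject₁≢suc (suc i) eq = inject₁≢suc i (suc-injective eq)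

det-additive-col : ∀ n (A B C : Matrix n) (c : Fin n) →
  (∀ r s → s ≢ c → A r s ≋ C r s × B r s ≋ C r s) →
  (∀ r → C r c ≋ A r c +ₚ B r c) →
  det n C ≋ det n A +ₚ det n B
det-additive-col n A B C c others col =
  ≋-trans (det-linear-col n A B C c 1ₚ others λ r →
             ≋-trans (col r) (+ₚ-cong (≋-refl {A r c}) (≋-sym (*ₚ-identityˡ (B r c)))))
          (+ₚ-cong (≋-refl {det n A}) (*ₚ-identityˡ (det n B)))

+ₚ≋0⇒≋-ₚ : ∀ a b → a +ₚ b ≋ 0ₚ → b ≋ -ₚ a
+ₚ≋0⇒≋-ₚ a b a+b≋0 = begin
  b                   ≈⟨ regroup a b ⟩
  (-ₚ a) +ₚ (a +ₚ b)  ≈⟨ +ₚ-cong (≋-refl { -ₚ a}) a+b≋0 ⟩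
  (-ₚ a) +ₚ 0ₚ        ≈⟨ +ₚ-identityʳ (-ₚ a) ⟩
  -ₚ a                ∎
  where
  open ≋-Reasoning
  regroup : ∀ a b → b ≋ (-ₚ a) +ₚ (a +ₚ b)
  regroup = RingSolver.solve-∀ ℤ[x]-almostCommutativeRing

module AdjacentCols {m} (A : Matrix (suc m)) (i : Fin m) where

  c d : Fin (suc m)
  c = inject₁ i
  d = suc i

  withCols : (u v : Fin (suc m) → Poly) → Matrix (suc m)
  withCols u v r s with s ≟ c | s ≟ d
  ... | yes _ | _     = u r
  ... | no _  | yes _ = v r
  ... | no _  | no _  = A r s

  withCols-c : ∀ u v r → withCols u v r c ≡ u r
  withCols-c u v r with c ≟ c
  ... | yes _ = refl
  ... | no c≢c = ⊥-elim (c≢c refl)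

  withCols-d : ∀ u v r → withCols u v r d ≡ v r
  withCols-d u v r with d ≟ c | d ≟ d
  ... | yes d≡c | _     = ⊥-elim (inject₁≢suc i (≡.sym d≡c))
  ... | no _    | yes _ = refl
  ... | no _    | no d≢d = ⊥-elim (d≢d refl)

  withCols-other : ∀ u v r s → s ≢ c → s ≢ d → withCols u v r s ≡ A r s
  withCols-other u v r s s≢c s≢d with s ≟ c | s ≟ d
  ... | yes s≡c | _       = ⊥-elim (s≢c s≡c)
  ... | no _    | yes s≡d = ⊥-elim (s≢d s≡d)
  ... | no _    | no _    = refl

  withCols-≢c : ∀ u u′ v r s → s ≢ c → withCols u v r s ≡ withCols u′ v r s
  withCols-≢c u u′ v r s s≢c with s ≟ c | s ≟ d
  ... | yes s≡c | _     = ⊥-elim (s≢c s≡c)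
  ... | no _    | yes _ = refl
  ... | no _    | no _  = refl

  withCols-≢d : ∀ u v v′ r s → s ≢ d → withCols u v r s ≡ withCols u v′ r s
  withCols-≢d u v v′ r s s≢d with s ≟ c | s ≟ d
  ... | yes _ | _       = refl
  ... | no _  | yes s≡d = ⊥-elim (s≢d s≡d)
  ... | no _  | no _    = refl

  withCols-≋ : ∀ (X : Matrix (suc m)) u v → (∀ r → u r ≋ X r c) → (∀ r → v r ≋ X r d) →
    (∀ r s → s ≢ c → s ≢ d → A r s ≋ X r s) → det (suc m) (withCols u v) ≋ det (suc m) X
  withCols-≋ X u v uc vd others = det-cong (suc m) cell
    where
    cell : ∀ r s → withCols u v r s ≋ X r s
    cell r s with s ≟ c | s ≟ d
    ... | yes refl | _        = uc r
    ... | no _     | yes refl = vd r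
    ... | no s≢c   | no s≢d   = others r s s≢c s≢d

  det-withCols-same : ∀ u → det (suc m) (withCols u u) ≋ 0ₚ
  det-withCols-same u = det-adjacent-equal-cols m (withCols u u) i λ r →
    ≡⇒≋ (≡.trans (withCols-c u u r) (≡.sym (withCols-d u u r)))

  det-withCols-+ˡ : ∀ u u′ v →
    det (suc m) (withCols (λ r → u r +ₚ u′ r) v) ≋ det (suc m) (withCols u v) +ₚ det (suc m) (withCols u′ v)
  det-withCols-+ˡ u u′ v = det-additive-col (suc m) (withCols u v) (withCols u′ v) (withCols (λ r → u r +ₚ u′ r) v) c
    (λ r s s≢c → ≡⇒≋ (withCols-≢c u _ v r s s≢c) , ≡⇒≋ (withCols-≢c u′ _ v r s s≢c))
    (λ r → ≡⇒≋ (≡.trans (withCols-c _ v r) (cong₂ _+ₚ_ (≡.sym (withCols-c u v r)) (≡.sym (withCols-c u′ v r)))))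

  det-withCols-+ʳ : ∀ u v v′ →
    det (suc m) (withCols u (λ r → v r +ₚ v′ r)) ≋ det (suc m) (withCols u v) +ₚ det (suc m) (withCols u v′)
  det-withCols-+ʳ u v v′ = det-additive-col (suc m) (withCols u v) (withCols u v′) (withCols u (λ r → v r +ₚ v′ r)) d
    (λ r s s≢d → ≡⇒≋ (withCols-≢d u v _ r s s≢d) , ≡⇒≋ (withCols-≢d u v′ _ r s s≢d))
    (λ r → ≡⇒≋ (≡.trans (withCols-d u _ r) (cong₂ _+ₚ_ (≡.sym (withCols-d u v r)) (≡.sym (withCols-d u v′ r)))))

  -- D(u, v) := det (withCols u v) is bilinear and alternating, so D(a, b) + D(b, a) = 0.
  det-swap-adjacent-cols : ∀ (B : Matrix (suc m)) → (∀ r → B r c ≋ A r d) → (∀ r → B r d ≋ A r c) →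
    (∀ r s → s ≢ c → s ≢ d → B r s ≋ A r s) → det (suc m) B ≋ -ₚ det (suc m) A
  det-swap-adjacent-cols B Bc Bd others = +ₚ≋0⇒≋-ₚ (det (suc m) A) (det (suc m) B) sum≋0
    where
    open ≋-Reasoning
    a b a+b : Fin (suc m) → Poly
    a r = A r c
    b r = A r d
    a+b r = a r +ₚ b r
    padWithZeros : ∀ x y → x +ₚ y ≋ (0ₚ +ₚ x) +ₚ (y +ₚ 0ₚ)
    padWithZeros = RingSolver.solve-∀ ℤ[x]-almostCommutativeRing
    sum≋0 : det (suc m) A +ₚ det (suc m) B ≋ 0ₚ
    sum≋0 = begin
      det (suc m) A +ₚ det (suc m) B
        ≈⟨ +ₚ-cong (≋-sym (withCols-≋ A a b (λ _ → ≋-refl) (λ _ → ≋-refl) (λ _ _ _ _ → ≋-refl)))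
                   (≋-sym (withCols-≋ B b a (≋-sym ∘ Bc) (≋-sym ∘ Bd)
                                      (λ r s s≢c s≢d → ≋-sym (others r s s≢c s≢d)))) ⟩
      det (suc m) (withCols a b) +ₚ det (suc m) (withCols b a)
        ≈⟨ padWithZeros (det (suc m) (withCols a b)) (det (suc m) (withCols b a)) ⟩
      (0ₚ +ₚ det (suc m) (withCols a b)) +ₚ (det (suc m) (withCols b a) +ₚ 0ₚ)
        ≈⟨ ≋-sym (+ₚ-cong (+ₚ-cong (det-withCols-same a) (≋-refl {det (suc m) (withCols a b)}))
                           (+ₚ-cong (≋-refl {det (suc m) (withCols b a)}) (det-withCols-same b))) ⟩
      (det (suc m) (withCols a a) +ₚ det (suc m) (withCols a b)) +ₚ (det (suc m) (withCols b a) +ₚ det (suc m) (withCols b b))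
        ≈⟨ ≋-sym (+ₚ-cong (det-withCols-+ʳ a a b) (det-withCols-+ʳ b a b)) ⟩
      det (suc m) (withCols a a+b) +ₚ det (suc m) (withCols b a+b)
        ≈⟨ ≋-sym (det-withCols-+ˡ a b a+b) ⟩
      det (suc m) (withCols a+b a+b)
        ≈⟨ det-withCols-same a+b ⟩
      0ₚ ∎

-- Swapping d with its left neighbour negates det and brings the two equal columns closer.
det-equal-cols-at-distance : ∀ n k (A : Matrix n) (c d : Fin n) → toℕ d ≡ k ℕ.+ suc (toℕ c) →
  (∀ r → A r c ≋ A r d) → det n A ≋ 0ₚ
det-equal-cols-at-distance (suc m) k A c zero d≡ e = ⊥-elim (ℕP.0≢1+n (≡.trans d≡ (ℕP.+-suc k (toℕ c))))
det-equal-cols-at-distance (suc m) zero A c (suc i) d≡ e = det-adjacent-equal-cols m A i λ r →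
  ≋-trans (≡⇒≋ (cong (A r) (≡.sym c≡))) (e r)
  where
  c≡ : c ≡ inject₁ i
  c≡ = toℕ-injective (≡.trans (≡.sym (ℕP.suc-injective d≡)) (≡.sym (toℕ-inject₁ i)))
det-equal-cols-at-distance (suc m) (suc k) A c (suc i) d≡ e = begin
  det (suc m) A
    ≈⟨ negate-twice (det (suc m) A) ⟩
  -ₚ (-ₚ det (suc m) A)
    ≈⟨ ·ₚ-congʳ _ (≋-sym (det-swap-adjacent-cols swapped (≡⇒≋ ∘ withCols-c _ _) (≡⇒≋ ∘ withCols-d _ _) unchanged)) ⟩
  -ₚ det (suc m) swapped
    ≈⟨ ·ₚ-congʳ _ (det-equal-cols-at-distance (suc m) k swapped c (inject₁ i) i≡ equal) ⟩
  -ₚ 0ₚ ∎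
  where
  open ≋-Reasoning
  open AdjacentCols A i using (withCols; withCols-c; withCols-d; withCols-other; det-swap-adjacent-cols)
  negate-twice : ∀ a → a ≋ -ₚ (-ₚ a)
  negate-twice = RingSolver.solve-∀ ℤ[x]-almostCommutativeRing
  swapped : Matrix (suc m)
  swapped = withCols (λ r → A r (suc i)) (λ r → A r (inject₁ i))
  unchanged : ∀ r s → s ≢ inject₁ i → s ≢ suc i → swapped r s ≋ A r s
  unchanged r s s≢c s≢d = ≡⇒≋ (withCols-other _ _ r s s≢c s≢d)
  i≡ : toℕ (inject₁ i) ≡ k ℕ.+ suc (toℕ c)
  i≡ = ≡.trans (toℕ-inject₁ i) (ℕP.suc-injective d≡)
  c≢ : c ≢ inject₁ i
  c≢ eq = ℕP.m≢1+n+m (toℕ c) (≡.trans (cong toℕ eq) (≡.trans i≡ (ℕP.+-suc k (toℕ c))))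
  c≢′ : c ≢ suc i
  c≢′ eq = ℕP.m≢1+n+m (toℕ c) (≡.trans (cong toℕ eq) (≡.trans d≡ (cong suc (ℕP.+-suc k (toℕ c)))))
  equal : ∀ r → swapped r c ≋ swapped r (inject₁ i)
  equal r = begin
    swapped r c          ≡⟨ withCols-other _ _ r c c≢ c≢′ ⟩
    A r c                ≈⟨ e r ⟩
    A r (suc i)          ≡⟨ withCols-c _ _ r ⟨
    swapped r (inject₁ i) ∎

det-equal-cols : ∀ n (A : Matrix n) (c d : Fin n) → c ≢ d → (∀ r → A r c ≋ A r d) → det n A ≋ 0ₚ
det-equal-cols n A c d c≢d e with ℕP.<-cmp (toℕ c) (toℕ d)
... | tri< c<d _ _ = det-equal-cols-at-distance n _ A c d (≡.sym (ℕP.m∸n+n≡m c<d)) e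
... | tri≈ _ c≡d _ = ⊥-elim (c≢d (toℕ-injective c≡d))
... | tri> _ _ d<c = det-equal-cols-at-distance n _ A d c (≡.sym (ℕP.m∸n+n≡m d<c)) (≋-sym ∘ e)

replaceCol : ∀ {n} → Matrix n → Fin n → (Fin n → Poly) → Matrix n
replaceCol A c v r s with s ≟ c
... | yes _ = v r
... | no _  = A r s

replaceCol-≡ : ∀ {n} (A : Matrix n) c v r → replaceCol A c v r c ≡ v r
replaceCol-≡ A c v r with c ≟ c
... | yes _  = refl
... | no c≢c = ⊥-elim (c≢c refl)

replaceCol-≢ : ∀ {n} (A : Matrix n) c v r s → s ≢ c → replaceCol A c v r s ≡ A r s
replaceCol-≢ A c v r s s≢c with s ≟ c
... | yes s≡c = ⊥-elim (s≢c s≡c)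
... | no _    = refl

replaceCol-cong : ∀ {n} (A : Matrix n) c {v w} → (∀ r → v r ≋ w r) →
  det n (replaceCol A c v) ≋ det n (replaceCol A c w)
replaceCol-cong {n} A c {v} {w} v≋w = det-cong n cell
  where
  cell : ∀ r s → replaceCol A c v r s ≋ replaceCol A c w r s
  cell r s with s ≟ c
  ... | yes _ = v≋w r
  ... | no _  = ≋-refl

replaceCol-self : ∀ {n} (A : Matrix n) c → det n (replaceCol A c (λ r → A r c)) ≋ det n A
replaceCol-self {n} A c = det-cong n cell
  where
  cell : ∀ r s → replaceCol A c (λ r → A r c) r s ≋ A r s
  cell r s with s ≟ c
  ... | yes refl = ≋-refl
  ... | no _     = ≋-refl

det-replaceCol-add-col : ∀ n (A : Matrix n) (c t : Fin n) → t ≢ c → ∀ v q →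
  det n (replaceCol A c (λ r → v r +ₚ q *ₚ A r t)) ≋ det n (replaceCol A c v)
det-replaceCol-add-col n A c t t≢c v q = begin
  det n (replaceCol A c (λ r → v r +ₚ q *ₚ A r t))
    ≈⟨ det-linear-col n (replaceCol A c v) (replaceCol A c colt) (replaceCol A c (λ r → v r +ₚ q *ₚ A r t)) c q
         (λ r s s≢c → ≡⇒≋ (≡.trans (replaceCol-≢ A c v r s s≢c) (≡.sym (replaceCol-≢ A c _ r s s≢c)))
                    , ≡⇒≋ (≡.trans (replaceCol-≢ A c colt r s s≢c) (≡.sym (replaceCol-≢ A c _ r s s≢c))))
         (λ r → ≡⇒≋ (≡.trans (replaceCol-≡ A c _ r)
                       (cong₂ (λ x y → x +ₚ q *ₚ y) (≡.sym (replaceCol-≡ A c v r)) (≡.sym (replaceCol-≡ A c colt r))))) ⟩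
  det n (replaceCol A c v) +ₚ q *ₚ det n (replaceCol A c colt)
    ≈⟨ +ₚ-cong (≋-refl {det n (replaceCol A c v)}) (*ₚ-congʳ q twoEqualCols) ⟩
  det n (replaceCol A c v) +ₚ q *ₚ 0ₚ
    ≈⟨ +ₚ-cong (≋-refl {det n (replaceCol A c v)}) (*ₚ-zeroʳ q) ⟩
  det n (replaceCol A c v) +ₚ 0ₚ
    ≈⟨ +ₚ-identityʳ _ ⟩
  det n (replaceCol A c v) ∎
  where
  open ≋-Reasoning
  colt : Fin n → Poly
  colt r = A r t
  twoEqualCols : det n (replaceCol A c colt) ≋ 0ₚ
  twoEqualCols = det-equal-cols n (replaceCol A c colt) c t (t≢c ∘ ≡.sym)
    (λ r → ≡⇒≋ (≡.trans (replaceCol-≡ A c colt r) (≡.sym (replaceCol-≢ A c colt r t t≢c))))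

punchIn-inject₁-fromℕ : ∀ {m} (j : Fin (suc m)) → punchIn (inject₁ j) (fromℕ m) ≡ fromℕ (suc m)
punchIn-inject₁-fromℕ zero            = refl
punchIn-inject₁-fromℕ {suc m} (suc j) = cong suc (punchIn-inject₁-fromℕ j)

punchIn-inject₁-inject₁ : ∀ {m} (j : Fin (suc m)) (c : Fin m) → punchIn (inject₁ j) (inject₁ c) ≡ inject₁ (punchIn j c)
punchIn-inject₁-inject₁ zero    c       = refl
punchIn-inject₁-inject₁ (suc j) zero    = refl
punchIn-inject₁-inject₁ (suc j) (suc c) = cong suc (punchIn-inject₁-inject₁ j c)

altSum-last-zero : ∀ n (f : Fin (suc n) → Poly) → f (fromℕ n) ≋ 0ₚ → altSum (suc n) f ≋ altSum n (f ∘ inject₁)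
altSum-last-zero zero    f z = +ₚ-cong z (≋-refl { -ₚ 0ₚ})
altSum-last-zero (suc n) f z = +ₚ-cong (≋-refl {f zero}) (·ₚ-congʳ _ (altSum-last-zero n (f ∘ suc) z))

det-unit-last-col : ∀ n (A : Matrix (suc n)) →
  A (fromℕ n) (fromℕ n) ≋ 1ₚ → (∀ r → A (inject₁ r) (fromℕ n) ≋ 0ₚ) →
  det (suc n) A ≋ det n (λ r c → A (inject₁ r) (inject₁ c))
det-unit-last-col zero A one zeros = begin
  A zero zero *ₚ 1ₚ +ₚ (-ₚ 0ₚ)  ≈⟨ +ₚ-identityʳ _ ⟩
  A zero zero *ₚ 1ₚ             ≈⟨ *ₚ-cong one (≋-refl {1ₚ}) ⟩
  1ₚ *ₚ 1ₚ                      ≈⟨ *ₚ-identityˡ 1ₚ ⟩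
  1ₚ                            ∎
  where open ≋-Reasoning
det-unit-last-col (suc m) A one zeros =
  ≋-trans (altSum-last-zero (suc m) expansion (≋0⇒*ₚ≋0 _ (zeros zero))) (altSum-cong (suc m) term)
  where
  expansion : Fin (suc (suc m)) → Poly
  expansion j = A zero j *ₚ det (suc m) (minor A j)
  term : ∀ j →
    expansion (inject₁ j) ≋ A zero (inject₁ j) *ₚ det m (λ r c → A (inject₁ (suc r)) (inject₁ (punchIn j c)))
  term j = *ₚ-congʳ (A zero (inject₁ j)) (≋-trans
    (det-unit-last-col m (minor A (inject₁ j))
      (≋-trans (≡⇒≋ (cong (A (fromℕ (suc m))) (punchIn-inject₁-fromℕ j))) one)
      (λ r → ≋-trans (≡⇒≋ (cong (A (suc (inject₁ r))) (punchIn-inject₁-fromℕ j))) (zeros (suc r))))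
    (det-cong m λ r c → ≡⇒≋ (cong (A (suc (inject₁ r))) (punchIn-inject₁-inject₁ j c))))

-- Entries of the Collatz matrix

𝟙[_] : Bool → Poly
𝟙[ b ] = if b then 1ₚ else 0ₚ

evenStep oddStep : ℕ → ℕ → Bool
evenStep i j = ((i % 2) ≡ᵇ 0) ∧ (1 <ᵇ i) ∧ (j ≡ᵇ (i / 2))
oddStep  i j = ((i % 2) ≡ᵇ 1) ∧ (j ≡ᵇ ((3 * i + 1) / 2))

≡ᵇ-reflects : ∀ m n → Reflects (m ≡ n) (m ≡ᵇ n)
≡ᵇ-reflects m n = Reflects.fromEquivalence (ℕP.≡ᵇ⇒≡ m n) (ℕP.≡⇒≡ᵇ m n)

reflects-⇔ : ∀ {A B : Set} {b} → (A → B) → (B → A) → Reflects A b → Reflects B b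
reflects-⇔ f g (ofʸ a)  = ofʸ (f a)
reflects-⇔ f g (ofⁿ ¬a) = ofⁿ (¬a ∘ g)

double%2 : ∀ j → 2 * j % 2 ≡ 0
double%2 j = ≡.trans (cong (_% 2) (ℕP.*-comm 2 j)) (m*n%n≡0 j 2)

positive-double : ∀ j → 1 ≤ 2 * j → 1 < 2 * j
positive-double (suc j) _ = ℕP.*-monoʳ-≤ 2 (s≤s z≤n)

evenStep-reflects : ∀ {i} j → 1 ≤ i → Reflects (i ≡ 2 * j) (evenStep i j)
evenStep-reflects {i} j 1≤i = reflects-⇔ halve double
  (≡ᵇ-reflects (i % 2) 0 ×-reflects (ℕP.<ᵇ-reflects-< 1 i ×-reflects ≡ᵇ-reflects j (i / 2)))
  where
  halve : i % 2 ≡ 0 × 1 < i × j ≡ i / 2 → i ≡ 2 * j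
  halve (even , _ , j≡) = begin
    i                    ≡⟨ m≡m%n+[m/n]*n i 2 ⟩
    i % 2 + i / 2 * 2    ≡⟨ cong₂ (λ a b → a + b * 2) even (≡.sym j≡) ⟩
    j * 2                ≡⟨ ℕP.*-comm j 2 ⟩
    2 * j                ∎
    where open ≡.≡-Reasoning
  double : i ≡ 2 * j → i % 2 ≡ 0 × 1 < i × j ≡ i / 2
  double refl = double%2 j , positive-double j 1≤i , ≡.sym twice/2
    where
    twice/2 : 2 * j / 2 ≡ j
    twice/2 = ≡.trans (cong (_/ 2) (ℕP.*-comm 2 j)) (m*n/n≡m j 2)

oddStep-reflects : ∀ i j → Reflects (i % 2 ≡ 1 × 3 * i + 1 ≡ 2 * j) (oddStep i j)
oddStep-reflects i j = reflects-⇔ (λ (odd , j≡) → odd , step odd j≡) (λ (odd , e) → odd , unstep e)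
  (≡ᵇ-reflects (i % 2) 1 ×-reflects ≡ᵇ-reflects j ((3 * i + 1) / 2))
  where
  unstep : 3 * i + 1 ≡ 2 * j → j ≡ (3 * i + 1) / 2
  unstep e = ≡.sym (≡.trans (cong (_/ 2) (≡.trans e (ℕP.*-comm 2 j))) (m*n/n≡m j 2))
  step : i % 2 ≡ 1 → j ≡ (3 * i + 1) / 2 → 3 * i + 1 ≡ 2 * j
  step odd j≡ = ≡.trans even (≡.trans (ℕP.*-comm _ 2) (cong (2 *_) (≡.sym j≡′)))
    where
    h = i / 2
    even : 3 * i + 1 ≡ (2 + 3 * h) * 2
    even = ≡.trans (cong (λ n → 3 * n + 1) (≡.trans (m≡m%n+[m/n]*n i 2) (cong (_+ h * 2) odd))) (regroup h)
      where
      regroup : ∀ h → 3 * (1 + h * 2) + 1 ≡ (2 + 3 * h) * 2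
      regroup = ℕ-Solver.solve-∀
    j≡′ : j ≡ 2 + 3 * h
    j≡′ = ≡.trans j≡ (≡.trans (cong (_/ 2) even) (m*n/n≡m (2 + 3 * h) 2))

if-split : ∀ {B E O : Set} {b e o} → Reflects B b → Reflects E e → Reflects O o →
  (B → ¬ E) → (B → ¬ O) → (E → ¬ O) →
  (if b then 1ₚ else if e then xₚ else if o then xₚ else 0ₚ) ≋ 𝟙[ b ] +ₚ xₚ *ₚ (𝟙[ e ] +ₚ 𝟙[ o ])
if-split (ofʸ β) (ofʸ ε) _       ¬βε _   _   = ⊥-elim (¬βε β ε)
if-split (ofʸ β) (ofⁿ _) (ofʸ ω) _   ¬βω _   = ⊥-elim (¬βω β ω)
if-split (ofʸ _) (ofⁿ _) (ofⁿ _) _   _   _   = solve₁ xₚ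
  where
  solve₁ : ∀ x → 1ₚ ≋ 1ₚ +ₚ x *ₚ (0ₚ +ₚ 0ₚ)
  solve₁ = RingSolver.solve-∀ ℤ[x]-almostCommutativeRing
if-split (ofⁿ _) (ofʸ ε) (ofʸ ω) _   _   ¬εω = ⊥-elim (¬εω ε ω)
if-split (ofⁿ _) (ofʸ _) (ofⁿ _) _   _   _   = solve₂ xₚ
  where
  solve₂ : ∀ x → x ≋ 0ₚ +ₚ x *ₚ (1ₚ +ₚ 0ₚ)
  solve₂ = RingSolver.solve-∀ ℤ[x]-almostCommutativeRing
if-split (ofⁿ _) (ofⁿ _) (ofʸ _) _   _   _   = solve₃ xₚ
  where
  solve₃ : ∀ x → x ≋ 0ₚ +ₚ x *ₚ (0ₚ +ₚ 1ₚ)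
  solve₃ = RingSolver.solve-∀ ℤ[x]-almostCommutativeRing
if-split (ofⁿ _) (ofⁿ _) (ofⁿ _) _   _   _   = solve₄ xₚ
  where
  solve₄ : ∀ x → 0ₚ ≋ 0ₚ +ₚ x *ₚ (0ₚ +ₚ 0ₚ)
  solve₄ = RingSolver.solve-∀ ℤ[x]-almostCommutativeRing

collatzEntry-split : ∀ {i} j → 1 ≤ i →
  collatzEntry i j ≋ 𝟙[ i ≡ᵇ j ] +ₚ xₚ *ₚ (𝟙[ evenStep i j ] +ₚ 𝟙[ oddStep i j ])
collatzEntry-split {i} j 1≤i =
  if-split (≡ᵇ-reflects i j) (evenStep-reflects j 1≤i) (oddStep-reflects i j) fixed-not-even fixed-not-odd even-not-odd
  where
  fixed-not-even : i ≡ j → ¬ i ≡ 2 * j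
  fixed-not-even refl e =
    ℕP.<-irrefl e (ℕP.<-≤-trans (ℕP.m<m+n i 1≤i) (ℕP.≤-reflexive (cong (λ n → i + n) (≡.sym (ℕP.+-identityʳ i)))))
  fixed-not-odd : i ≡ j → ¬ (i % 2 ≡ 1 × 3 * i + 1 ≡ 2 * j)
  fixed-not-odd refl (_ , e) = ℕP.<-irrefl (≡.sym e)
    (ℕP.≤-<-trans (ℕP.*-monoˡ-≤ i {2} {3} (s≤s (s≤s z≤n))) (ℕP.m<m+n (3 * i) (s≤s z≤n)))
  even-not-odd : i ≡ 2 * j → ¬ (i % 2 ≡ 1 × 3 * i + 1 ≡ 2 * j)
  even-not-odd refl (odd , _) = case ≡.trans (≡.sym odd) (double%2 j) of λ ()

-- Families k = c₀ + c₁ L and their certificates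

Affine : Set
Affine = ℕ × ℕ

⟦_⟧ : Affine → ℕ → ℕ
⟦ c₀ , c₁ ⟧ L = c₀ + c₁ * L

InRange : Affine → Affine → Set
InRange (K₀ , K₁) (c₀ , c₁) = 1 ≤ c₀ × c₀ < K₀ × c₁ ≤ K₁

inRange-⟦⟧ : ∀ {K y} → InRange K y → ∀ L → 1 ≤ ⟦ y ⟧ L × ⟦ y ⟧ L < ⟦ K ⟧ L
inRange-⟦⟧ {K₀ , K₁} {c₀ , c₁} (1≤c₀ , c₀<K₀ , c₁≤K₁) L =
  ℕP.≤-trans 1≤c₀ (ℕP.m≤m+n c₀ (c₁ * L)) , ℕP.+-mono-<-≤ c₀<K₀ (ℕP.*-monoˡ-≤ L c₁≤K₁)

data EvenChild : Affine → Affine → Maybe Affine → Set where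
  inside  : ∀ {K₀ K₁ c₀ c₁} → 2 * c₀ ≤ K₀ → 2 * c₁ ≤ K₁ →
            EvenChild (K₀ , K₁) (c₀ , c₁) (just (2 * c₀ , 2 * c₁))
  outside : ∀ {K₀ K₁ c₀ c₁} → K₀ < 2 * c₀ → K₁ ≤ 2 * c₁ →
            EvenChild (K₀ , K₁) (c₀ , c₁) nothing

-- The odd preimage (2y - 1)/3 of y is tracked only when 3 ∣ c₁; then whether it is an odd
-- integer does not depend on L.
data OddChild : Affine → Maybe Affine → Set where
  odd-quotient  : ∀ {c₀ c₁ q e} → c₁ ≡ e * 3 → 2 * c₀ ≡ 1 + q * 3 → q % 2 ≡ 1 →
                  OddChild (c₀ , c₁) (just (q , 2 * e))
  even-quotient : ∀ {c₀ c₁ q e} → c₁ ≡ e * 3 → 2 * c₀ ≡ 1 + q * 3 → q % 2 ≡ 0 →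
                  OddChild (c₀ , c₁) nothing
  not-1-mod-3   : ∀ {c₀ c₁ e} → c₁ ≡ e * 3 → 2 * c₀ % 3 ≢ 1 →
                  OddChild (c₀ , c₁) nothing

hits : ℕ → Maybe Affine → ℕ → Bool
hits L (just c) i = i ≡ᵇ ⟦ c ⟧ L
hits L nothing  i = false

double-⟦⟧ : ∀ c₀ c₁ L → 2 * (c₀ + c₁ * L) ≡ 2 * c₀ + 2 * c₁ * L
double-⟦⟧ = ℕ-Solver.solve-∀

evenStep-child : ∀ {K y e} → EvenChild K y e → ∀ L {i} → 1 ≤ i → i ≤ ⟦ K ⟧ L →
  evenStep i (⟦ y ⟧ L) ≡ hits L e i
evenStep-child {y = c₀ , c₁} (inside _ _) L {i} 1≤i _ = Reflects.det (evenStep-reflects (⟦ c₀ , c₁ ⟧ L) 1≤i)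
  (reflects-⇔ (λ e → ≡.trans e (≡.sym (double-⟦⟧ c₀ c₁ L))) (λ e → ≡.trans e (double-⟦⟧ c₀ c₁ L))
               (≡ᵇ-reflects i _))
evenStep-child {K₀ , K₁} {c₀ , c₁} (outside K₀<2c₀ K₁≤2c₁) L {i} 1≤i i≤K =
  Reflects.det (evenStep-reflects (⟦ c₀ , c₁ ⟧ L) 1≤i) (ofⁿ λ i≡ → ℕP.<-irrefl i≡ (ℕP.≤-<-trans i≤K K<2y))
  where
  K<2y : K₀ + K₁ * L < 2 * (c₀ + c₁ * L)
  K<2y = ℕP.<-≤-trans (ℕP.+-mono-<-≤ K₀<2c₀ (ℕP.*-monoˡ-≤ L K₁≤2c₁))
                      (ℕP.≤-reflexive (≡.sym (double-⟦⟧ c₀ c₁ L)))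

double-⟦⟧-3∣ : ∀ c₀ {c₁} e L → c₁ ≡ e * 3 → 2 * (c₀ + c₁ * L) ≡ 2 * c₀ + 2 * e * L * 3
double-⟦⟧-3∣ c₀ e L refl = regroup c₀ e L
  where
  regroup : ∀ c₀ e L → 2 * (c₀ + e * 3 * L) ≡ 2 * c₀ + 2 * e * L * 3
  regroup = ℕ-Solver.solve-∀

3n+1-injective : ∀ m n → 3 * m + 1 ≡ 3 * n + 1 → m ≡ n
3n+1-injective m n e = ℕP.*-cancelˡ-≡ m n 3 (ℕP.+-cancelʳ-≡ 1 (3 * m) (3 * n) e)

double-⟦⟧-quotient : ∀ c₀ {c₁} q e L → c₁ ≡ e * 3 → 2 * c₀ ≡ 1 + q * 3 →
  2 * (c₀ + c₁ * L) ≡ 3 * (q + 2 * e * L) + 1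
double-⟦⟧-quotient c₀ q e L c₁≡ 2c₀≡ =
  ≡.trans (double-⟦⟧-3∣ c₀ e L c₁≡) (≡.trans (cong (_+ 2 * e * L * 3) 2c₀≡) (regroup q e L))
  where
  regroup : ∀ q e L → 1 + q * 3 + 2 * e * L * 3 ≡ 3 * (q + 2 * e * L) + 1
  regroup = ℕ-Solver.solve-∀

parity-⟦⟧ : ∀ q e L → (q + 2 * e * L) % 2 ≡ q % 2
parity-⟦⟧ q e L = ≡.trans (cong (λ n → (q + n) % 2) (regroup e L)) ([m+kn]%n≡m%n q (e * L) 2)
  where
  regroup : ∀ e L → 2 * e * L ≡ e * L * 2
  regroup = ℕ-Solver.solve-∀

oddStep-child : ∀ {y o} → OddChild y o → ∀ L i → oddStep i (⟦ y ⟧ L) ≡ hits L o i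
oddStep-child {c₀ , c₁} (odd-quotient {q = q} {e} c₁≡ 2c₀≡ q-odd) L i =
  Reflects.det (oddStep-reflects i (⟦ c₀ , c₁ ⟧ L))
    (reflects-⇔ (λ { refl → ≡.trans (parity-⟦⟧ q e L) q-odd , ≡.sym 2y≡ })
                (λ (_ , step) → 3n+1-injective i _ (≡.trans step 2y≡))
                (≡ᵇ-reflects i (q + 2 * e * L)))
  where
  2y≡ = double-⟦⟧-quotient c₀ q e L c₁≡ 2c₀≡
oddStep-child {c₀ , c₁} (even-quotient {q = q} {e} c₁≡ 2c₀≡ q-even) L i =
  Reflects.det (oddStep-reflects i (⟦ c₀ , c₁ ⟧ L)) (ofⁿ λ (i-odd , step) →
    case ≡.trans (≡.sym q-even) (≡.trans (≡.sym (parity-⟦⟧ q e L)) (≡.trans (cong (_% 2) (≡.sym (i≡ step))) i-odd))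
    of λ ())
  where
  i≡ : 3 * i + 1 ≡ 2 * (c₀ + c₁ * L) → i ≡ q + 2 * e * L
  i≡ step = 3n+1-injective i (q + 2 * e * L) (≡.trans step (double-⟦⟧-quotient c₀ q e L c₁≡ 2c₀≡))
oddStep-child {c₀ , c₁} (not-1-mod-3 {e = e} c₁≡ 2c₀≢) L i =
  Reflects.det (oddStep-reflects i (⟦ c₀ , c₁ ⟧ L)) (ofⁿ λ (_ , step) → 2c₀≢ (begin
    2 * c₀ % 3                          ≡⟨ [m+kn]%n≡m%n (2 * c₀) (2 * e * L) 3 ⟨
    (2 * c₀ + 2 * e * L * 3) % 3        ≡⟨ cong (_% 3) (double-⟦⟧-3∣ c₀ e L c₁≡) ⟨
    2 * (c₀ + c₁ * L) % 3               ≡⟨ cong (_% 3) step ⟨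
    (3 * i + 1) % 3                     ≡⟨ cong (_% 3) (regroup i) ⟩
    (1 + i * 3) % 3                     ≡⟨ [m+kn]%n≡m%n 1 i 3 ⟩
    1                                   ∎))
  where
  open ≡.≡-Reasoning
  regroup : ∀ i → 3 * i + 1 ≡ 1 + i * 3
  regroup = ℕ-Solver.solve-∀

-- A certificate, uniform in L, that the backward Collatz tree of y below k is finite and stays
-- inside [1, k); its columns can then be used to clear the entry of y from the last column.
data Reducible (K : Affine) : Affine → Set
data ChildrenReducible (K : Affine) : Affine → Set

data ChildrenReducible K where
  children : ∀ {y e o} → EvenChild K y e → OddChild y o →
             MaybeAll.All (Reducible K) e → MaybeAll.All (Reducible K) o → ChildrenReducible K y

data Reducible K where
  node : ∀ {y} → InRange K y → ChildrenReducible K y → Reducible K y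

inRange? : ∀ K y → Dec (InRange K y)
inRange? (K₀ , K₁) (c₀ , c₁) = 1 ℕP.≤? c₀ ×-dec (c₀ ℕP.<? K₀ ×-dec c₁ ℕP.≤? K₁)

evenChild? : ∀ K y → Maybe (∃ (EvenChild K y))
evenChild? (K₀ , K₁) (c₀ , c₁) with 2 * c₀ ℕP.≤? K₀ | 2 * c₁ ℕP.≤? K₁ | K₀ ℕP.<? 2 * c₀ | K₁ ℕP.≤? 2 * c₁
... | yes a | yes b | _     | _     = just (_ , inside a b)
... | _     | _     | yes a | yes b = just (_ , outside a b)
... | _     | _     | _     | _     = nothing

divMod3 : ∀ m {r} → m % 3 ≡ r → m ≡ r + m / 3 * 3
divMod3 m m%3≡r = ≡.trans (m≡m%n+[m/n]*n m 3) (cong (_+ m / 3 * 3) m%3≡r)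

oddChild? : ∀ y → Maybe (∃ (OddChild y))
oddChild? (c₀ , c₁) with c₁ % 3 ℕP.≟ 0 | 2 * c₀ % 3 ℕP.≟ 1 | 2 * c₀ / 3 % 2 ℕP.≟ 1 | 2 * c₀ / 3 % 2 ℕP.≟ 0
... | yes 3∣c₁ | yes r≡1 | yes odd | _        =
  just (_ , odd-quotient {q = 2 * c₀ / 3} {c₁ / 3} (divMod3 c₁ 3∣c₁) (divMod3 (2 * c₀) r≡1) odd)
... | yes 3∣c₁ | yes r≡1 | _       | yes even =
  just (_ , even-quotient {q = 2 * c₀ / 3} {c₁ / 3} (divMod3 c₁ 3∣c₁) (divMod3 (2 * c₀) r≡1) even)
... | yes 3∣c₁ | no r≢1  | _       | _        =
  just (_ , not-1-mod-3 {e = c₁ / 3} (divMod3 c₁ 3∣c₁) r≢1)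
... | _        | _       | _       | _        = nothing

reducible? : ℕ → ∀ K y → Maybe (Reducible K y)
childrenReducible? : ℕ → ∀ K y → Maybe (ChildrenReducible K y)
allReducible? : ℕ → ∀ K c → Maybe (MaybeAll.All (Reducible K) c)

reducible? zero    K y = nothing
reducible? (suc n) K y with inRange? K y | childrenReducible? n K y
... | yes r | just c = just (node r c)
... | _     | _      = nothing

childrenReducible? n K y with evenChild? K y | oddChild? y
... | just (e , ev) | just (o , od) with allReducible? n K e | allReducible? n K o
...   | just re | just ro = just (children ev od re ro)
...   | _       | _       = nothing
childrenReducible? n K y | _ | _ = nothing

allReducible? n K nothing  = just MaybeAll.nothing
allReducible? n K (just c) = Maybe.map MaybeAll.just (reducible? n K c)

-- Clearing the last column of M_k

≡ᵇ-refl : ∀ m → (m ≡ᵇ m) ≡ true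
≡ᵇ-refl m = Reflects.det (≡ᵇ-reflects m m) (ofʸ refl)

≡ᵇ-≢ : ∀ {m n} → m ≢ n → (m ≡ᵇ n) ≡ false
≡ᵇ-≢ {m} {n} m≢n = Reflects.det (≡ᵇ-reflects m n) (ofⁿ m≢n)

M-inject₁ : ∀ m (r c : Fin m) → M (suc m) (inject₁ r) (inject₁ c) ≡ M m r c
M-inject₁ m r c = cong₂ (λ a b → collatzEntry (suc a) (suc b)) (toℕ-inject₁ r) (toℕ-inject₁ c)

module ColumnReduction (K : Affine) (L m : ℕ) (K≡ : ⟦ K ⟧ L ≡ suc m) where

  row : Fin (suc m) → ℕ
  row r = suc (toℕ r)

  -- Column vectors v are indexed by 1-based row numbers, like collatzEntry.
  D : (ℕ → Poly) → Poly
  D v = det (suc m) (replaceCol (M (suc m)) (fromℕ m) (v ∘ row))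

  D-cong : ∀ {v w} → (∀ i → 1 ≤ i → i ≤ ⟦ K ⟧ L → v i ≋ w i) → D v ≋ D w
  D-cong v≋w = replaceCol-cong (M (suc m)) (fromℕ m) λ r →
    v≋w (row r) (s≤s z≤n) (≡.subst (row r ≤_) (≡.sym K≡) (toℕ<n r))

  D-add-column : ∀ y → 1 ≤ y → y < ⟦ K ⟧ L → ∀ v q → D (λ i → v i +ₚ q *ₚ collatzEntry i y) ≋ D v
  D-add-column (suc y) _ y<k v q = ≋-trans
    (D-cong λ i _ _ → ≡⇒≋ (cong (λ t → v i +ₚ q *ₚ collatzEntry i (suc t)) (≡.sym (toℕ-fromℕ< y<1+m))))
    (det-replaceCol-add-col (suc m) (M (suc m)) (fromℕ m) (fromℕ< y<1+m) t≢last (v ∘ row) q)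
    where
    y<m : y < m
    y<m = ℕP.≤-pred (≡.subst (suc y <_) K≡ y<k)
    y<1+m : y < suc m
    y<1+m = ℕP.m<n⇒m<1+n y<m
    t≢last : fromℕ< y<1+m ≢ fromℕ m
    t≢last eq = ℕP.<-irrefl (≡.trans (≡.sym (toℕ-fromℕ< _)) (≡.trans (cong toℕ eq) (toℕ-fromℕ m))) y<m

  offDiagonal : ℕ → ℕ → Poly
  offDiagonal i j = collatzEntry i j +ₚ (-ₚ 𝟙[ i ≡ᵇ j ])

  offDiagonal-children : ∀ {y e o} → EvenChild K y e → OddChild y o → ∀ i → 1 ≤ i → i ≤ ⟦ K ⟧ L →
    offDiagonal i (⟦ y ⟧ L) ≋ xₚ *ₚ (𝟙[ hits L e i ] +ₚ 𝟙[ hits L o i ])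
  offDiagonal-children {y} {e} {o} ev od i 1≤i i≤k = begin
    collatzEntry i (⟦ y ⟧ L) +ₚ (-ₚ 𝟙[ i ≡ᵇ ⟦ y ⟧ L ])
      ≈⟨ +ₚ-cong (collatzEntry-split (⟦ y ⟧ L) 1≤i) ≋-refl ⟩
    (𝟙[ i ≡ᵇ ⟦ y ⟧ L ] +ₚ xₚ *ₚ (𝟙[ evenStep i (⟦ y ⟧ L) ] +ₚ 𝟙[ oddStep i (⟦ y ⟧ L) ]))
      +ₚ (-ₚ 𝟙[ i ≡ᵇ ⟦ y ⟧ L ])
      ≈⟨ cancel 𝟙[ i ≡ᵇ ⟦ y ⟧ L ] _ ⟩
    xₚ *ₚ (𝟙[ evenStep i (⟦ y ⟧ L) ] +ₚ 𝟙[ oddStep i (⟦ y ⟧ L) ])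
      ≡⟨ cong₂ (λ a b → xₚ *ₚ (𝟙[ a ] +ₚ 𝟙[ b ])) (evenStep-child ev L 1≤i i≤k) (oddStep-child od L i) ⟩
    xₚ *ₚ (𝟙[ hits L e i ] +ₚ 𝟙[ hits L o i ]) ∎
    where
    open ≋-Reasoning
    cancel : ∀ a b → (a +ₚ b) +ₚ (-ₚ a) ≋ b
    cancel = RingSolver.solve-∀ ℤ[x]-almostCommutativeRing

  reduce : ∀ {y} → Reducible K y → ∀ q v → D (λ i → v i +ₚ q *ₚ 𝟙[ i ≡ᵇ ⟦ y ⟧ L ]) ≋ D v
  clear : ∀ {y} → ChildrenReducible K y → ∀ q v → D (λ i → v i +ₚ q *ₚ offDiagonal i (⟦ y ⟧ L)) ≋ D v
  clear-hits : ∀ {c} → MaybeAll.All (Reducible K) c → ∀ q v → D (λ i → v i +ₚ q *ₚ 𝟙[ hits L c i ]) ≋ D v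

  reduce {y} (node y∈ cs) q v = begin
    D (λ i → v i +ₚ q *ₚ 𝟙[ i ≡ᵇ ⟦ y ⟧ L ])
      ≈⟨ D-add-column (⟦ y ⟧ L) (proj₁ (inRange-⟦⟧ y∈ L)) (proj₂ (inRange-⟦⟧ y∈ L))
                      (λ i → v i +ₚ q *ₚ 𝟙[ i ≡ᵇ ⟦ y ⟧ L ]) (-ₚ q) ⟨
    D (λ i → (v i +ₚ q *ₚ 𝟙[ i ≡ᵇ ⟦ y ⟧ L ]) +ₚ (-ₚ q) *ₚ collatzEntry i (⟦ y ⟧ L))
      ≈⟨ D-cong (λ i _ _ → regroup (v i) q 𝟙[ i ≡ᵇ ⟦ y ⟧ L ] (collatzEntry i (⟦ y ⟧ L))) ⟩
    D (λ i → v i +ₚ (-ₚ q) *ₚ offDiagonal i (⟦ y ⟧ L))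
      ≈⟨ clear cs (-ₚ q) v ⟩
    D v ∎
    where
    open ≋-Reasoning
    regroup : ∀ v q δ a → (v +ₚ q *ₚ δ) +ₚ (-ₚ q) *ₚ a ≋ v +ₚ (-ₚ q) *ₚ (a +ₚ (-ₚ δ))
    regroup = RingSolver.solve-∀ ℤ[x]-almostCommutativeRing

  clear {y} (children {e = e} {o} ev od re ro) q v = begin
    D (λ i → v i +ₚ q *ₚ offDiagonal i (⟦ y ⟧ L))
      ≈⟨ D-cong (λ i 1≤i i≤k → ≋-trans (+ₚ-cong (≋-refl {v i}) (*ₚ-congʳ q (offDiagonal-children ev od i 1≤i i≤k)))
                                         (regroup (v i) q xₚ 𝟙[ hits L e i ] 𝟙[ hits L o i ])) ⟩
    D (λ i → (v i +ₚ (q *ₚ xₚ) *ₚ 𝟙[ hits L e i ]) +ₚ (q *ₚ xₚ) *ₚ 𝟙[ hits L o i ])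
      ≈⟨ clear-hits ro (q *ₚ xₚ) (λ i → v i +ₚ (q *ₚ xₚ) *ₚ 𝟙[ hits L e i ]) ⟩
    D (λ i → v i +ₚ (q *ₚ xₚ) *ₚ 𝟙[ hits L e i ])
      ≈⟨ clear-hits re (q *ₚ xₚ) v ⟩
    D v ∎
    where
    open ≋-Reasoning
    regroup : ∀ v q x a b → v +ₚ q *ₚ (x *ₚ (a +ₚ b)) ≋ (v +ₚ (q *ₚ x) *ₚ a) +ₚ (q *ₚ x) *ₚ b
    regroup = RingSolver.solve-∀ ℤ[x]-almostCommutativeRing

  clear-hits MaybeAll.nothing  q v = D-cong λ i _ _ → ≋-trans (+ₚ-cong (≋-refl {v i}) (*ₚ-zeroʳ q)) (+ₚ-identityʳ (v i))
  clear-hits (MaybeAll.just r) q v = reduce r q v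

  D-last-column : D (λ i → collatzEntry i (⟦ K ⟧ L)) ≋ det (suc m) (M (suc m))
  D-last-column = ≋-trans
    (replaceCol-cong (M (suc m)) (fromℕ m) λ r →
      ≡⇒≋ (cong (λ k → collatzEntry (row r) k) (≡.trans K≡ (cong suc (≡.sym (toℕ-fromℕ m))))))
    (replaceCol-self (M (suc m)) (fromℕ m))

  D-unit : D (λ i → 𝟙[ i ≡ᵇ ⟦ K ⟧ L ]) ≋ det m (M m)
  D-unit = ≋-trans (det-unit-last-col m A corner above) (det-cong m block)
    where
    A : Matrix (suc m)
    A = replaceCol (M (suc m)) (fromℕ m) (λ r → 𝟙[ row r ≡ᵇ ⟦ K ⟧ L ])
    corner : A (fromℕ m) (fromℕ m) ≋ 1ₚ
    corner = ≡⇒≋ (≡.trans (replaceCol-≡ (M (suc m)) (fromℕ m) _ (fromℕ m))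
      (cong 𝟙[_] (≡.trans (cong₂ _≡ᵇ_ (cong suc (toℕ-fromℕ m)) K≡) (≡ᵇ-refl m))))
    above : ∀ r → A (inject₁ r) (fromℕ m) ≋ 0ₚ
    above r = ≡⇒≋ (≡.trans (replaceCol-≡ (M (suc m)) (fromℕ m) _ (inject₁ r))
      (cong 𝟙[_] (≡ᵇ-≢ λ eq → toℕ-inject₁-≢ r (≡.sym (ℕP.suc-injective (≡.trans eq K≡))))))
    block : ∀ r c → A (inject₁ r) (inject₁ c) ≋ M m r c
    block r c = ≡⇒≋ (≡.trans (replaceCol-≢ (M (suc m)) (fromℕ m) _ (inject₁ r) (inject₁ c) (fromℕ≢inject₁ ∘ ≡.sym))
      (M-inject₁ m r c))

  -- k is kept apart from suc m so that callers never have to unfold det to match sizes.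
  det-M-succ : ∀ k → k ≡ suc m → ChildrenReducible K K → det k (M k) ≋ det m (M m)
  det-M-succ .(suc m) refl cs = begin
    det (suc m) (M (suc m))
      ≈⟨ D-last-column ⟨
    D (λ i → collatzEntry i (⟦ K ⟧ L))
      ≈⟨ D-cong (λ i _ _ → split 𝟙[ i ≡ᵇ ⟦ K ⟧ L ] (collatzEntry i (⟦ K ⟧ L))) ⟩
    D (λ i → 𝟙[ i ≡ᵇ ⟦ K ⟧ L ] +ₚ 1ₚ *ₚ offDiagonal i (⟦ K ⟧ L))
      ≈⟨ clear cs 1ₚ (λ i → 𝟙[ i ≡ᵇ ⟦ K ⟧ L ]) ⟩
    D (λ i → 𝟙[ i ≡ᵇ ⟦ K ⟧ L ])
      ≈⟨ D-unit ⟩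
    det m (M m) ∎
    where
    open ≋-Reasoning
    split : ∀ δ a → a ≋ δ +ₚ 1ₚ *ₚ (a +ₚ (-ₚ δ))
    split = RingSolver.solve-∀ ℤ[x]-almostCommutativeRing

_∈AP_ : ℕ → ℕ × ℕ → Set
l ∈AP (a , b) = ∃ λ q → l ≡ a + b * q

sizeForm : ℕ → ℕ → ℕ × ℕ → Affine
sizeForm c d (a , b) = (suc c + d * a , d * b)

-- A search of depth 20; for closed arguments T (certified …) normalises to ⊤ when it succeeds.
certified : ℕ → ℕ → ℕ × ℕ → Bool
certified c d p = Maybe.is-just (childrenReducible? 20 (sizeForm c d p) (sizeForm c d p))

witness : ∀ {A : Set} (m : Maybe A) → T (Maybe.is-just m) → A
witness (just x) _ = x

det-M-succ-progression : ∀ k₀ n₀ d p → k₀ ≡ suc n₀ → T (certified n₀ d p) → ∀ {l} → l ∈AP p →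
  det (k₀ + d * l) (M (k₀ + d * l)) ≈ₚ det (n₀ + d * l) (M (n₀ + d * l))
det-M-succ-progression .(suc n₀) n₀ d (a , b) refl ok (q , refl) = ≋⇒≈ₚ
  (ColumnReduction.det-M-succ (sizeForm n₀ d (a , b)) q (n₀ + d * (a + b * q)) (regroup n₀ d a b q) _ refl (witness _ ok))
  where
  regroup : ∀ c d a b q → suc c + d * a + d * b * q ≡ suc (c + d * (a + b * q))
  regroup = ℕ-Solver.solve-∀

det-M-succ-progressions : ∀ k₀ n₀ d ps → k₀ ≡ suc n₀ → T (all (certified n₀ d) ps) → ∀ {l} → Any (l ∈AP_) ps →
  det (k₀ + d * l) (M (k₀ + d * l)) ≈ₚ det (n₀ + d * l) (M (n₀ + d * l))
det-M-succ-progressions k₀ n₀ d (p ∷ ps) k₀≡ ok (here l∈p) =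
  det-M-succ-progression k₀ n₀ d p k₀≡ (proj₁ (Equivalence.to T-∧ ok)) l∈p
det-M-succ-progressions k₀ n₀ d (p ∷ ps) k₀≡ ok (there l∈ps) =
  det-M-succ-progressions k₀ n₀ d ps k₀≡ (proj₂ (Equivalence.to T-∧ ok)) l∈ps

-- Reduction of the hypotheses on l to arithmetic progressions

0<3 : 0 < 3
0<3 = s≤s z≤n

1<3 : 1 < 3
1<3 = s≤s (s≤s z≤n)

2<3 : 2 < 3
2<3 = s≤s (s≤s (s≤s z≤n))

3∣+n : ∀ {n} → + 3 ∣ + n → ∃ λ q → n ≡ 3 * q
3∣+n (divides q n≡) = q , ≡.trans n≡ (ℕP.*-comm q 3)

3∣+n-r : ∀ n r → r < 3 → + 3 ∣ (+ n ℤ.- + r) → ∃ λ q → n ≡ r + 3 * q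
3∣+n-r n r r<3 (divides q eq) with r ℕP.≤? n
... | yes r≤n = q , (begin
  n             ≡⟨ ℕP.m+[n∸m]≡n r≤n ⟨
  r + (n ∸ r)   ≡⟨ cong (λ x → r + x) (≡.trans (≡.sym ∣n⊖r∣) eq) ⟩
  r + q * 3     ≡⟨ cong (λ x → r + x) (ℕP.*-comm q 3) ⟩
  r + 3 * q     ∎)
  where
  open ≡.≡-Reasoning
  ∣n⊖r∣ : ∣ + n ℤ.- + r ∣ ≡ n ∸ r
  ∣n⊖r∣ = cong ∣_∣ (≡.trans (ℤP.m-n≡m⊖n n r) (ℤP.⊖-≥ r≤n))
... | no r≰n = ⊥-elim (no-multiple q (≡.trans (≡.sym ∣n⊖r∣) eq))
  where
  ∣n⊖r∣ : ∣ + n ℤ.- + r ∣ ≡ r ∸ n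
  ∣n⊖r∣ = ≡.trans (cong ∣_∣ (ℤP.m-n≡m⊖n n r)) (ℤP.∣⊖∣-< (ℕP.≰⇒> r≰n))
  no-multiple : ∀ q → r ∸ n ≡ q * 3 → ⊥
  no-multiple zero    e = r≰n (ℕP.m∸n≡0⇒m≤n e)
  no-multiple (suc p) e = ℕP.<⇒≱ r<3
    (ℕP.≤-trans (ℕP.m≤m+n 3 (p * 3)) (ℕP.≤-trans (ℕP.≤-reflexive (≡.sym e)) (ℕP.m∸n≤m r n)))

nonnegative-progression : ∀ {l r} z → r < 3 → + l ≡ + r ℤ.+ + 3 ℤ.* z → ∃ λ n → z ≡ + n × l ≡ r + 3 * n
nonnegative-progression {l} {r} (+ n) _ e =
  n , refl , ℤP.+-injective (≡.trans e (cong (λ x → + r ℤ.+ x) (≡.sym (ℤP.pos-* 3 n))))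
nonnegative-progression {l} {r} -[1+ n ] r<3 e =
  ⊥-elim (ℕP.<⇒≱ r<3 (ℕP.≤-trans 3≤3n (ℕP.≤-trans (ℕP.m≤n+m _ l) (ℕP.≤-reflexive l+3n≡r))))
  where
  3≤3n : 3 ≤ 3 * suc n
  3≤3n = ℕP.*-monoʳ-≤ 3 (s≤s z≤n)
  cancel : ∀ c x → (c ℤ.+ + 3 ℤ.* (ℤ.- x)) ℤ.+ + 3 ℤ.* x ≡ c
  cancel = ℤ-Solver.solve-∀
  l+3n≡r : l + 3 * suc n ≡ r
  l+3n≡r = ℤP.+-injective (≡.trans (cong (λ x → + l ℤ.+ x) (ℤP.pos-* 3 (suc n)))
    (≡.trans (cong (ℤ._+ + 3 ℤ.* + suc n) e) (cancel (+ r) (+ suc n))))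

progressionsA progressionsB : List (ℕ × ℕ)
progressionsA = (3 , 3) ∷ (1 , 3) ∷ (5 , 9) ∷ (2 , 27) ∷ (8 , 27) ∷ (17 , 27) ∷ []
progressionsB = (2 , 3) ∷ (1 , 9) ∷ (9 , 9) ∷ []

substitute-progression : ∀ {l n} r s a b q → l ≡ r + s * n → n ≡ a + b * q → l ≡ (r + s * a) + (s * b) * q
substitute-progression r s a b q l≡ refl = ≡.trans l≡ (regroup r s a b q)
  where
  regroup : ∀ r s a b q → r + s * (a + b * q) ≡ (r + s * a) + (s * b) * q
  regroup = ℕ-Solver.solve-∀

residuesA : ∀ l → 1 ≤ l →
  ((+ 3 ∣ + l) ⊎ (+ 3 ∣ (+ l ℤ.- + 1)))
  ⊎ (∃ λ (l₁ : ℤ) → (+ l ≡ + 2 ℤ.+ + 3 ℤ.* l₁) × (+ 3 ∣ (l₁ ℤ.- + 1)))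
  ⊎ (∃ λ (l₁ : ℤ) → (+ l ≡ + 2 ℤ.+ + 3 ℤ.* l₁) ×
      ((∃ λ (l₂ : ℤ) → (l₁ ≡ + 3 ℤ.* l₂) × (+ 3 ∣ l₂))
       ⊎ (∃ λ (l₂ : ℤ) → (l₁ ≡ + 2 ℤ.+ + 3 ℤ.* l₂) × ((+ 3 ∣ l₂) ⊎ (+ 3 ∣ (l₂ ℤ.- + 1))))))
  → Any (l ∈AP_) progressionsA
residuesA l 1≤l (inj₁ (inj₁ 3∣l)) with 3∣+n 3∣l
... | zero  , refl = case 1≤l of λ ()
... | suc q , refl = here (q , ℕP.*-suc 3 q)
residuesA l _ (inj₁ (inj₂ 3∣l-1)) = there (here (3∣+n-r l 1 1<3 3∣l-1))
residuesA l _ (inj₂ (inj₁ (l₁ , l≡ , 3∣l₁-1))) with nonnegative-progression l₁ 2<3 l≡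
... | n , refl , l≡′ with 3∣+n-r n 1 1<3 3∣l₁-1
... | q , n≡ = there (there (here (q , substitute-progression 2 3 1 3 q l≡′ n≡)))
residuesA l _ (inj₂ (inj₂ (l₁ , l≡ , inj₁ (l₂ , l₁≡ , 3∣l₂)))) with nonnegative-progression l₁ 2<3 l≡
... | n , refl , l≡′ with nonnegative-progression l₂ 0<3 (≡.trans l₁≡ (≡.sym (ℤP.+-identityˡ _)))
... | n′ , refl , n≡ with 3∣+n 3∣l₂
... | q , n′≡ = there (there (there (here (q ,
  substitute-progression 2 3 0 9 q l≡′ (substitute-progression 0 3 0 3 q n≡ n′≡)))))
residuesA l _ (inj₂ (inj₂ (l₁ , l≡ , inj₂ (l₂ , l₁≡ , 3∣l₂⊎3∣l₂-1)))) with nonnegative-progression l₁ 2<3 l≡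
... | n , refl , l≡′ with nonnegative-progression l₂ 2<3 l₁≡
... | n′ , refl , n≡ with 3∣l₂⊎3∣l₂-1
... | inj₁ 3∣l₂ = let q , n′≡ = 3∣+n 3∣l₂ in there (there (there (there (here (q ,
  substitute-progression 2 3 2 9 q l≡′ (substitute-progression 2 3 0 3 q n≡ n′≡))))))
... | inj₂ 3∣l₂-1 = let q , n′≡ = 3∣+n-r n′ 1 1<3 3∣l₂-1 in there (there (there (there (there (here (q ,
  substitute-progression 2 3 5 9 q l≡′ (substitute-progression 2 3 1 3 q n≡ n′≡)))))))

residuesB : ∀ l → 1 ≤ l →
  (+ 3 ∣ (+ l ℤ.- + 2))
  ⊎ ((∃ λ (l₁ : ℤ) → (+ l ≡ + 1 ℤ.+ + 3 ℤ.* l₁) × (+ 3 ∣ l₁))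
     ⊎ (∃ λ (l₁ : ℤ) → (+ l ≡ + 3 ℤ.* l₁) × (+ 3 ∣ l₁)))
  → Any (l ∈AP_) progressionsB
residuesB l _ (inj₁ 3∣l-2) = here (3∣+n-r l 2 2<3 3∣l-2)
residuesB l _ (inj₂ (inj₁ (l₁ , l≡ , 3∣l₁))) with nonnegative-progression l₁ 1<3 l≡
... | n , refl , l≡′ = let q , n≡ = 3∣+n 3∣l₁ in there (here (q , substitute-progression 1 3 0 3 q l≡′ n≡))
residuesB l 1≤l (inj₂ (inj₂ (l₁ , l≡ , 3∣l₁))) with nonnegative-progression l₁ 0<3 (≡.trans l≡ (≡.sym (ℤP.+-identityˡ _)))
... | n , refl , l≡′ with 3∣+n 3∣l₁
... | zero  , refl = case ≡.subst (1 ≤_) l≡′ 1≤l of λ ()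
... | suc q , n≡   = there (there (here (q , substitute-progression 0 3 3 3 q l≡′ (≡.trans n≡ (ℕP.*-suc 3 q)))))

theorem2p1 : (∀ (l : ℕ) → 1 ≤ l →
    ((+ 3 ∣ + l) ⊎ (+ 3 ∣ (+ l ℤ.- + 1)))
    ⊎ (∃ λ (l₁ : ℤ) → (+ l ≡ + 2 ℤ.+ + 3 ℤ.* l₁) × (+ 3 ∣ (l₁ ℤ.- + 1)))
    ⊎ (∃ λ (l₁ : ℤ) → (+ l ≡ + 2 ℤ.+ + 3 ℤ.* l₁) ×
    ((∃ λ (l₂ : ℤ) → (l₁ ≡ + 3 ℤ.* l₂) × (+ 3 ∣ l₂))
    ⊎ (∃ λ (l₂ : ℤ) → (l₁ ≡ + 2 ℤ.+ + 3 ℤ.* l₂) × ((+ 3 ∣ l₂) ⊎ (+ 3 ∣ (l₂ ℤ.- + 1))))))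
    → det (44 ℕ.+ 54 ℕ.* l) (M (44 ℕ.+ 54 ℕ.* l)) ≈ₚ det (43 ℕ.+ 54 ℕ.* l) (M (43 ℕ.+ 54 ℕ.* l)))
    ×
    (∀ (l : ℕ) → 1 ≤ l →
    (+ 3 ∣ (+ l ℤ.- + 2))
    ⊎ ((∃ λ (l₁ : ℤ) → (+ l ≡ + 1 ℤ.+ + 3 ℤ.* l₁) × (+ 3 ∣ l₁))
    ⊎ (∃ λ (l₁ : ℤ) → (+ l ≡ + 3 ℤ.* l₁) × (+ 3 ∣ l₁)))
    → det (26 ℕ.+ 54 ℕ.* l) (M (26 ℕ.+ 54 ℕ.* l)) ≈ₚ det (25 ℕ.+ 54 ℕ.* l) (M (25 ℕ.+ 54 ℕ.* l)))
theorem2p1 =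
  (λ l 1≤l h → det-M-succ-progressions 44 43 54 progressionsA refl _ (residuesA l 1≤l h)) ,
  (λ l 1≤l h → det-M-succ-progressions 26 25 54 progressionsB refl _ (residuesB l 1≤l h))
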